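{- Let $k\geq 1$ and let $G$ be a connected graph with diameter $d$, radius $r$ and girth $g$. Then (1) $\gamma^r_k(G)\geq \frac{d+1}{2k+1}$; (2) $\gamma^r_k(G)\geq \frac{2r}{2k+1}$; (3) $\gamma^r_k(G)\geq \frac{g}{2k+1}$ if $g<\infty$. Each of these bounds is sharp (attained by some graph for every $k\ge 1$).
   Context: For a graph $G=(V,E)$ and $k\geq 1$, a set $D\subseteq V$ is distance $k$-dominating if every $v\in V\setminus D$ is at distance at most $k$ from some vertex of $D$. An ordered set $W=\{w_1,\dots,w_r\}$ is a resolving set if for all distinct $u,v\in V\setminus W$ the distance vectors $(d_G(u,w_i))_i$ and $(d_G(v,w_i))_i$ differ. $\gamma^r_k(G)$ is the minimum cardinality of a set that is both resolving and distance $k$-dominating. Diameter/radius are the maximum/minimum eccentricity; the girth is the length of a shortest cycle ($\infty$ if acyclic). -}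

module Defs where

open import Data.Nat using (ℕ; zero; suc; _+_; _*_; _≤_)
open import Data.Bool using (Bool; T)
open import Data.Fin using (Fin; zero; suc; inject₁; fromℕ)
open import Data.Fin.Subset using (Subset; _∈_; _∉_; ∣_∣)
open import Data.Product using (Σ; ∃; _×_; _,_)
open import Relation.Binary.PropositionalEquality using (_≡_; _≢_)
open import Relation.Nullary using (¬_)
open import Function.Definitions using (Injective)

record Graph (n : ℕ) : Set where
  field
    adj   : Fin n → Fin n → Bool
    sym   : ∀ u v → adj u v ≡ adj v u
    irrefl : ∀ u → ¬ T (adj u u)

open Graph public

Edge : ∀ {n} → Graph n → Fin n → Fin n → Set
Edge G u v = T (adj G u v)

data Walk {n : ℕ} (G : Graph n) : Fin n → Fin n → ℕ → Set where
  nil  : ∀ u → Walk G u u 0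
  cons : ∀ {u v w m} → Edge G u v → Walk G v w m → Walk G u w (suc m)

Connected : ∀ {n} → Graph n → Set
Connected G = ∀ u v → ∃ λ m → Walk G u v m

Dist : ∀ {n} → Graph n → Fin n → Fin n → ℕ → Set
Dist G u v m = Walk G u v m × (∀ m' → Walk G u v m' → m ≤ m')

IsEcc : ∀ {n} → Graph n → Fin n → ℕ → Set
IsEcc {n} G v e = (∃ λ (u : Fin n) → Dist G v u e) × (∀ u m → Dist G v u m → m ≤ e)

IsDiameter : ∀ {n} → Graph n → ℕ → Set
IsDiameter {n} G d = (∃ λ (v : Fin n) → IsEcc G v d) × (∀ v e → IsEcc G v e → e ≤ d)

IsRadius : ∀ {n} → Graph n → ℕ → Set
IsRadius {n} G r = (∃ λ (v : Fin n) → IsEcc G v r) × (∀ v e → IsEcc G v e → r ≤ e)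

record Cycle {n : ℕ} (G : Graph n) (m : ℕ) : Set where
  field
    vs    : Fin (suc m) → Fin n
    inj   : Injective _≡_ _≡_ vs
    step  : ∀ (i : Fin m) → Edge G (vs (inject₁ i)) (vs (suc i))
    close : Edge G (vs (fromℕ m)) (vs zero)

HasCycleOfLength : ∀ {n} → Graph n → ℕ → Set
HasCycleOfLength G L = ∃ λ m → (L ≡ suc m) × (3 ≤ L) × Cycle G m

-- girth = length of a shortest cycle (only meaningful when a cycle exists, g < ∞)
IsGirth : ∀ {n} → Graph n → ℕ → Set
IsGirth G g = HasCycleOfLength G g × (∀ L → HasCycleOfLength G L → g ≤ L)

IsDistKDominating : ∀ {n} → Graph n → ℕ → Subset n → Set
IsDistKDominating {n} G k D =
  ∀ v → v ∉ D → ∃ λ (w : Fin n) → w ∈ D × (∃ λ m → Dist G v w m × m ≤ k)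

-- W is a resolving set (only vertices outside W need to be distinguished)
IsResolving : ∀ {n} → Graph n → Subset n → Set
IsResolving {n} G W =
  ∀ u v → u ≢ v → u ∉ W → v ∉ W →
    ∃ λ (w : Fin n) → w ∈ W × (∃ λ a → ∃ λ b → Dist G u w a × Dist G v w b × a ≢ b)

IsResolvingDistKDominating : ∀ {n} → Graph n → ℕ → Subset n → Set
IsResolvingDistKDominating G k D = IsResolving G D × IsDistKDominating G k D

IsGammaRK : ∀ {n} → Graph n → ℕ → ℕ → Set
IsGammaRK {n} G k γ =
  (∃ λ (D : Subset n) → IsResolvingDistKDominating G k D × ∣ D ∣ ≡ γ)
  × (∀ D → IsResolvingDistKDominating G k D → γ ≤ ∣ D ∣)

{-# OPTIONS --safe #-}
-- Let D be a distance-k-dominating set of the connected graph G. Because G is connected, the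
-- elements of D can be taken one at a time so that each new one lies within 2k + 1 of an earlier
-- one. Along the way we keep a centre, a vertex or an edge {x, y} (b = 0 or 1), and a radius q
-- such that all elements taken so far are within q of x or y; a new element at distance at most
-- q + 2k + 1 from x is absorbed by sliding the centre half-way towards it, which keeps
-- 2q + b ≤ (2k + 1)(s − 1) after s elements. At the end every vertex lies within R = q + k of
-- x or y, and 2R + b + 1 ≤ (2k + 1)|D|. Hence d ≤ 2R + b and r ≤ R + b; and on any cycle, two
-- descents of the level min(d(x, ·), d(y, ·)) from its highest vertex close up to a cycle of
-- length at most 2R + b + 1, so g ≤ 2R + b + 1 as well. The path on 4k + 2 vertices
-- (γ = 2) and the cycle on 6k + 3 vertices (γ = 3) attain the bounds.
module Submission where

open import Defs hiding (sym)
open import Data.Bool using (T; true; false)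
open import Data.Bool.Properties using (T?)
open import Data.Fin using (Fin; zero; suc; toℕ; fromℕ; fromℕ<; inject₁)
open import Data.Fin.Properties using (any?; pigeonhole; ¬∀⟶∃¬; toℕ-fromℕ; toℕ-fromℕ<; toℕ-inject₁; toℕ-injective; toℕ<n)
import Data.Fin.Properties as Finₚ
open import Data.Fin.Subset using (Subset; _∈_; _∉_; ∣_∣; ⁅_⁆; _∪_; _⊆_)
open import Data.Fin.Subset.Properties
  using (_∈?_; p⊆q⇒∣p∣≤∣q∣; p⊂q⇒∣p∣<∣q∣; x∈p∪q⁺; x∈p∪q⁻; x∈⁅x⁆; x∈⁅y⁆⇒x≡y; p⊆p∪q; q⊆p∪q; ∣⁅x⁆∣≡1; ∪-identityʳ)
open import Data.Nat using (ℕ; zero; suc; _+_; _*_; _∸_; _≤_; _<_; z≤n; s≤s; ∣_-_∣; _≤?_; _<?_; _≟_; _⊓_; _/_; _%_)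
open import Data.Nat.DivMod using (m≡m%n+[m/n]*n; m%n<n)
open import Data.Nat.Properties
open import Data.Nat.Tactic.RingSolver using (solve-∀)
open import Data.Product using (Σ; ∃; _×_; _,_; proj₁; proj₂)
open import Data.Sum using (_⊎_; inj₁; inj₂; [_,_]′; swap; map₂)
open import Data.Unit using (⊤; tt)
open import Data.Vec using (_∷_; here; there)
open import Function.Definitions using (Injective)
open import Relation.Binary.Definitions using (tri<; tri≈; tri>)
open import Relation.Binary.PropositionalEquality using (_≡_; _≢_; refl; sym; trans; cong; cong₂; subst; subst₂; module ≡-Reasoning)
open import Relation.Nullary using (¬_; Dec; yes; no; contradiction)
open import Relation.Nullary.Decidable using (isYes; toWitness; fromWitness; _×-dec_; _⊎-dec_; ¬?)

-- Walks, paths and distances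

module Walks {n : ℕ} (G : Graph n) where

  infix 4 _∼_
  _∼_ : Fin n → Fin n → Set
  u ∼ v = Edge G u v

  ∼-sym : ∀ {u v} → u ∼ v → v ∼ u
  ∼-sym {u} {v} = subst T (Graph.sym G u v)

  _∼?_ : ∀ u v → Dec (u ∼ v)
  u ∼? v = T? (adj G u v)

  data WalkIn (P : Fin n → Set) : Fin n → Fin n → ℕ → Set where
    stay : ∀ {u} → P u → WalkIn P u u 0
    move : ∀ {u v w m} → P u → u ∼ v → WalkIn P v w m → WalkIn P u w (suc m)

  Walk′ : Fin n → Fin n → ℕ → Set
  Walk′ = WalkIn (λ _ → ⊤)

  module _ {P : Fin n → Set} where

    head-P : ∀ {u v m} → WalkIn P u v m → P u
    head-P (stay p) = p
    head-P (move p _ _) = p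

    toWalk : ∀ {u v m} → WalkIn P u v m → Walk G u v m
    toWalk (stay _) = nil _
    toWalk (move _ e w) = cons e (toWalk w)

    infixr 5 _++_
    _++_ : ∀ {u v w a b} → WalkIn P u v a → WalkIn P v w b → WalkIn P u w (a + b)
    stay _ ++ w = w
    move p e w ++ w′ = move p e (w ++ w′)

    snoc : ∀ {u v w m} → WalkIn P u v m → v ∼ w → P w → WalkIn P u w (suc m)
    snoc (stay p) e p′ = move p e (stay p′)
    snoc (move p e w) e′ p′ = move p e (snoc w e′ p′)

    reverse : ∀ {u v m} → WalkIn P u v m → WalkIn P v u m
    reverse (stay p) = stay p
    reverse (move p e w) = snoc (reverse w) (∼-sym e) p

    cast : ∀ {u v a b} → a ≡ b → WalkIn P u v a → WalkIn P u v b
    cast refl w = w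

    splitAt : ∀ {u w} a {c} → WalkIn P u w (a + c) → Σ (Fin n) λ z → WalkIn P u z a × WalkIn P z w c
    splitAt zero w = _ , stay (head-P w) , w
    splitAt (suc a) (move p e w) with splitAt a w
    ... | z , w₁ , w₂ = z , move p e w₁ , w₂

    length0⇒≡ : ∀ {u v} → WalkIn P u v 0 → u ≡ v
    length0⇒≡ (stay _) = refl

    length1⇒∼ : ∀ {u v} → WalkIn P u v 1 → u ∼ v
    length1⇒∼ (move _ e (stay _)) = e

  fromWalk : ∀ {u v m} → Walk G u v m → Walk′ u v m
  fromWalk (nil _) = stay tt
  fromWalk (cons e w) = move tt e (fromWalk w)

  mapWalkIn : ∀ {P P′ : Fin n → Set} → (∀ {x} → P x → P′ x) → ∀ {u v m} → WalkIn P u v m → WalkIn P′ u v m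
  mapWalkIn f (stay p) = stay (f p)
  mapWalkIn f (move p e w) = move (f p) e (mapWalkIn f w)

  forget : ∀ {P u v m} → WalkIn P u v m → Walk′ u v m
  forget = mapWalkIn (λ _ → tt)

  WalkIn? : ∀ {P} → (∀ x → Dec (P x)) → ∀ m u v → Dec (WalkIn P u v m)
  WalkIn? P? zero u v with P? u | u Finₚ.≟ v
  ... | yes p | yes refl = yes (stay p)
  ... | no ¬p | _ = no λ { (stay p) → ¬p p }
  ... | yes _ | no u≢v = no λ { (stay _) → u≢v refl }
  WalkIn? P? (suc m) u v with P? u | any? (λ x → (u ∼? x) ×-dec WalkIn? P? m x v)
  ... | no ¬p | _ = no λ { (move p _ _) → ¬p p }
  ... | yes p | yes (x , e , w) = yes (move p e w)
  ... | yes _ | no ∄x = no λ { (move _ e w) → ∄x (_ , e , w) }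

  Within : Fin n → Fin n → ℕ → Set
  Within a v q = Σ ℕ λ m → Walk′ a v m × m ≤ q

  walk⇒within : ∀ {a b m} → Walk′ a b m → Within a b m
  walk⇒within w = _ , w , ≤-refl

  edge⇒within : ∀ {a b} → a ∼ b → Within a b 1
  edge⇒within e = walk⇒within (move tt e (stay tt))

  within-refl : ∀ {a} q → Within a a q
  within-refl q = 0 , stay tt , z≤n

  within-mono : ∀ {a v q q′} → q ≤ q′ → Within a v q → Within a v q′
  within-mono q≤q′ (m , w , m≤q) = m , w , ≤-trans m≤q q≤q′

  within-sym : ∀ {a v q} → Within a v q → Within v a q
  within-sym (m , w , m≤q) = m , reverse w , m≤q

  within-trans : ∀ {a b c q r} → Within a b q → Within b c r → Within a c (q + r)
  within-trans (m , w , m≤q) (m′ , w′ , m′≤r) = m + m′ , w ++ w′ , +-mono-≤ m≤q m′≤r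

  Shortest : (P : Fin n → Set) → Fin n → Fin n → ℕ → Set
  Shortest P u v m = WalkIn P u v m × (∀ m′ → WalkIn P u v m′ → m ≤ m′)

  shortest : ∀ {P} → (∀ x → Dec (P x)) → ∀ {u v m₀} → WalkIn P u v m₀ → Σ ℕ λ m → m ≤ m₀ × Shortest P u v m
  shortest {P} P? {u} {v} {m₀} w₀ = search m₀ 0 refl (λ _ ())
    where
      search : ∀ f i → i + f ≡ m₀ → (∀ j → j < i → ¬ WalkIn P u v j) → Σ ℕ λ m → m ≤ m₀ × Shortest P u v m
      search f i i+f≡m₀ none<i with WalkIn? P? i u v
      ... | yes w = i , subst (i ≤_) i+f≡m₀ (m≤m+n i f) , w , λ m′ w′ → ≮⇒≥ (λ m′<i → none<i m′ m′<i w′)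
      search zero i i+0≡m₀ none<i | no ¬w = contradiction (cast (sym (trans (sym (+-identityʳ i)) i+0≡m₀)) w₀) ¬w
      search (suc f) i i+sf≡m₀ none<i | no ¬w =
        search f (suc i) (trans (sym (+-suc i f)) i+sf≡m₀) λ j j<1+i wj →
          [ (λ j<i → none<i j j<i wj) , (λ { refl → ¬w wj }) ]′ (m<1+n⇒m<n∨m≡n j<1+i)

module Paths {n : ℕ} (G : Graph n) where
  open Walks G

  vertex : ∀ {P u v m} → WalkIn P u v m → Fin (suc m) → Fin n
  vertex (stay {u} _) _ = u
  vertex (move {u} _ _ _) zero = u
  vertex (move _ _ w) (suc i) = vertex w i

  vertex-P : ∀ {P u v m} (w : WalkIn P u v m) i → P (vertex w i)
  vertex-P (stay p) _ = p
  vertex-P (move p _ _) zero = p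
  vertex-P (move _ _ w) (suc i) = vertex-P w i

  vertex-zero : ∀ {P u v m} (w : WalkIn P u v m) → vertex w zero ≡ u
  vertex-zero (stay _) = refl
  vertex-zero (move _ _ _) = refl

  vertex-last : ∀ {P u v m} (w : WalkIn P u v m) → vertex w (fromℕ m) ≡ v
  vertex-last (stay _) = refl
  vertex-last (move _ _ w) = vertex-last w

  vertex-∼ : ∀ {P u v m} (w : WalkIn P u v m) (i : Fin m) → vertex w (inject₁ i) ∼ vertex w (suc i)
  vertex-∼ (move _ e w) zero = subst (_ ∼_) (sym (vertex-zero w)) e
  vertex-∼ (move _ _ w) (suc i) = vertex-∼ w i

  vertex-forget : ∀ {P u v m} (w : WalkIn P u v m) i → vertex (forget w) i ≡ vertex w i
  vertex-forget (stay _) i = refl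
  vertex-forget (move _ _ w) zero = refl
  vertex-forget (move _ _ w) (suc i) = vertex-forget w i

  suffix : ∀ {P u v m} (w : WalkIn P u v m) (i : Fin (suc m)) → WalkIn P (vertex w i) v (m ∸ toℕ i)
  suffix (stay p) zero = stay p
  suffix (move p e w) zero = move p e w
  suffix (move p e w) (suc i) = suffix w i

  IsPath : ∀ {P u v m} → WalkIn P u v m → Set
  IsPath w = Injective _≡_ _≡_ (vertex w)

  move-isPath : ∀ {P u v w m} (p : P u) (e : u ∼ v) (π : WalkIn P v w m) →
                IsPath π → (∀ i → vertex π i ≢ u) → IsPath (move p e π)
  move-isPath p e π π-path u∉π {zero}  {zero}  eq = refl
  move-isPath p e π π-path u∉π {zero}  {suc j} eq = contradiction (sym eq) (u∉π j)
  move-isPath p e π π-path u∉π {suc i} {zero}  eq = contradiction eq (u∉π i)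
  move-isPath p e π π-path u∉π {suc i} {suc j} eq = cong suc (π-path eq)

  forget-isPath : ∀ {P u v m} (π : WalkIn P u v m) → IsPath π → IsPath (forget π)
  forget-isPath π π-path {i} {j} eq = π-path (trans (sym (vertex-forget π i)) (trans eq (vertex-forget π j)))

  -- a repeated vertex would let the walk skip the segment between its two visits
  shortest⇒isPath : ∀ {P u v m} (π : WalkIn P u v m) → (∀ m′ → WalkIn P u v m′ → m ≤ m′) → IsPath π
  shortest⇒isPath (stay _) _ {zero} {zero} _ = refl
  shortest⇒isPath {P} {v = v} (move {m = m} p e π) minimal =
    move-isPath p e π (shortest⇒isPath π λ m′ π′ → ≤-pred (minimal (suc m′) (move p e π′)))
      λ i eq → <-irrefl refl
        (≤-trans (minimal (m ∸ toℕ i) (subst (λ z → WalkIn P z v (m ∸ toℕ i)) eq (suffix π i))) (m∸n≤m m (toℕ i)))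

  path+edge⇒cycle : ∀ {P a c L} (π : WalkIn P a c L) → IsPath π → 2 ≤ L → c ∼ a → HasCycleOfLength G (suc L)
  path+edge⇒cycle π π-path 2≤L c∼a = _ , refl , s≤s 2≤L , record
    { vs = vertex π
    ; inj = π-path
    ; step = vertex-∼ π
    ; close = subst₂ _∼_ (sym (vertex-last π)) (sym (vertex-zero π)) c∼a }

argmax : ∀ {m} → Fin m → (f : Fin m → ℕ) → Σ (Fin m) λ i → ∀ j → f j ≤ f i
argmax {suc zero} _ f = zero , λ { zero → ≤-refl }
argmax {suc (suc m)} _ f with argmax zero (λ j → f (suc j))
... | i , fi-max with f zero ≤? f (suc i)
...   | yes f0≤ = suc i , λ { zero → f0≤ ; (suc j) → fi-max j }
...   | no f0≰ = zero , λ { zero → ≤-refl ; (suc j) → ≤-trans (fi-max j) (<⇒≤ (≰⇒> f0≰)) }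

module Distance {n : ℕ} (G : Graph n) (connected : Connected G) where
  open Walks G

  private
    shortestWalk : ∀ u v → Σ ℕ λ m → m ≤ proj₁ (connected u v) × Shortest (λ _ → ⊤) u v m
    shortestWalk u v = shortest (λ _ → yes tt) (fromWalk (proj₂ (connected u v)))

  abstract
    dist : Fin n → Fin n → ℕ
    dist u v = proj₁ (shortestWalk u v)

    dist-walk : ∀ u v → Walk′ u v (dist u v)
    dist-walk u v = proj₁ (proj₂ (proj₂ (shortestWalk u v)))

    dist-minimal : ∀ {u v m} → Walk′ u v m → dist u v ≤ m
    dist-minimal {u} {v} w = proj₂ (proj₂ (proj₂ (shortestWalk u v))) _ w

  dist-Dist : ∀ u v → Dist G u v (dist u v)
  dist-Dist u v = toWalk (dist-walk u v) , λ _ w → dist-minimal (fromWalk w)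

  Dist⇒≡dist : ∀ {u v m} → Dist G u v m → m ≡ dist u v
  Dist⇒≡dist {u} {v} (w , minimal) = ≤-antisym (minimal _ (toWalk (dist-walk u v))) (dist-minimal (fromWalk w))

  within⇒dist≤ : ∀ {u v q} → Within u v q → dist u v ≤ q
  within⇒dist≤ (m , w , m≤q) = ≤-trans (dist-minimal w) m≤q

  eccentricity≤ : ∀ x B → (∀ u → Within x u B) → ∃ λ e → IsEcc G x e × e ≤ B
  eccentricity≤ x B all-within with argmax x (dist x)
  ... | far , far-max = dist x far ,
        ((far , dist-Dist x far) , λ u m d → subst (_≤ dist x far) (sym (Dist⇒≡dist d)) (far-max u)) ,
        within⇒dist≤ (all-within far)

-- Centres and the greedy covering

module Centres {n : ℕ} (G : Graph n) where
  open Walks G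

  Link : Fin n → Fin n → ℕ → Set
  Link x y b = (b ≡ 0 × x ≡ y) ⊎ (b ≡ 1 × x ∼ y)

  link-sym : ∀ {x y b} → Link x y b → Link y x b
  link-sym (inj₁ (b≡0 , refl)) = inj₁ (b≡0 , refl)
  link-sym (inj₂ (b≡1 , e)) = inj₂ (b≡1 , ∼-sym e)

  link≤1 : ∀ {x y b} → Link x y b → b ≤ 1
  link≤1 (inj₁ (refl , _)) = z≤n
  link≤1 (inj₂ (refl , _)) = ≤-refl

  link⇒within : ∀ {x y b} → Link x y b → Within x y b
  link⇒within (inj₁ (refl , refl)) = within-refl 0
  link⇒within (inj₂ (refl , e)) = edge⇒within e

  walk≤1⇒link : ∀ {x y b} → Walk′ x y b → b ≤ 1 → Link x y b
  walk≤1⇒link w z≤n = inj₁ (refl , length0⇒≡ w)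
  walk≤1⇒link w (s≤s z≤n) = inj₂ (refl , length1⇒∼ w)

  -- b = 0: the single vertex x = y; b = 1: the edge xy. Covered vertices are pairwise joined by
  -- walks of length at most 2 q + b, so the budget bounds the diameter of what is covered.
  record Centre (S : Fin n → Set) (budget : ℕ) : Set where
    constructor centre
    field
      {x y}  : Fin n
      {b q}  : ℕ
      link   : Link x y b
      covers : ∀ v → S v → Within x v q ⊎ Within y v q
      bound  : 2 * q + b ≤ budget

  centre-swap : ∀ {S B} → Centre S B → Centre S B
  centre-swap (centre link covers bound) = centre (link-sym link) (λ v s → swap (covers v s)) bound

  centre-within-x : ∀ {S B} (C : Centre S B) → let open Centre C in ∀ v → S v → Within x v (q + b)
  centre-within-x (centre {b = b} {q} link covers _) v s with covers v s
  ... | inj₁ x-near = within-mono (m≤m+n q b) x-near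
  ... | inj₂ y-near = within-mono (≤-reflexive (+-comm b q)) (within-trans (link⇒within link) y-near)

  -- Walking s steps out from x towards the new vertex, the centre moves ⌊s/2⌋ steps and
  -- becomes an edge when s is odd.
  absorb : ∀ {S : Fin n → Set} {x w c} s → (∀ v → S v → Within x v c) → Walk′ x w (c + s) →
           Centre (λ v → S v ⊎ v ≡ w) (2 * c + s)
  absorb {S} {x} {w} {c} s near-x walk with splitAt (s / 2) (cast length≡ walk)
    where
      length≡ : c + s ≡ s / 2 + (s % 2 + (c + s / 2))
      length≡ = trans (cong (c +_) (m≡m%n+[m/n]*n s 2)) (regroup c (s % 2) (s / 2))
        where regroup : ∀ c b t → c + (b + t * 2) ≡ t + (b + (c + t))
              regroup = solve-∀
  ... | z , x⇝z , z⇝w with splitAt (s % 2) z⇝w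
  ... | z′ , z⇝z′ , z′⇝w = centre (walk≤1⇒link z⇝z′ (≤-pred (m%n<n s 2))) covers bound
    where
      covers : ∀ v → S v ⊎ v ≡ w → Within z v (c + s / 2) ⊎ Within z′ v (c + s / 2)
      covers v (inj₁ Sv) = inj₁ (within-mono (≤-reflexive (+-comm (s / 2) c)) (within-trans (walk⇒within (reverse x⇝z)) (near-x v Sv)))
      covers v (inj₂ refl) = inj₂ (walk⇒within z′⇝w)
      bound : 2 * (c + s / 2) + s % 2 ≤ 2 * c + s
      bound = ≤-reflexive (trans (regroup c (s % 2) (s / 2)) (cong (2 * c +_) (sym (m≡m%n+[m/n]*n s 2))))
        where regroup : ∀ c b t → 2 * (c + t) + b ≡ 2 * c + (b + t * 2)
              regroup = solve-∀

  centre-mono : ∀ {S S′ : Fin n → Set} {B B′} → (∀ {v} → S′ v → S v) → B ≤ B′ → Centre S B → Centre S′ B′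
  centre-mono S′⊆S B≤B′ (centre link covers bound) = centre link (λ v s → covers v (S′⊆S s)) (≤-trans bound B≤B′)

  extend : ∀ {S : Fin n → Set} {B M w} → 1 ≤ M → (C : Centre S B) → let open Centre C in
           Within x w (q + M) → Centre (λ v → S v ⊎ v ≡ w) (B + M)
  extend {S} {B} {M} {w} 1≤M C@(centre {x = x} {b = b} {q} link covers bound) (d , x⇝w , d≤q+M) with d ≤? q + b
  ... | yes d≤q+b = centre (inj₁ (refl , refl)) covers′ bound′
    where
      covers′ : ∀ v → S v ⊎ v ≡ w → Within x v (q + b) ⊎ Within x v (q + b)
      covers′ v (inj₁ s) = inj₁ (centre-within-x C v s)
      covers′ v (inj₂ refl) = inj₁ (d , x⇝w , d≤q+b)
      bound′ : 2 * (q + b) + 0 ≤ B + M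
      bound′ = begin
        2 * (q + b) + 0 ≡⟨ regroup q b ⟩
        2 * q + b + b   ≤⟨ +-mono-≤ bound (≤-trans (link≤1 link) 1≤M) ⟩
        B + M           ∎
        where open ≤-Reasoning
              regroup : ∀ q b → 2 * (q + b) + 0 ≡ 2 * q + b + b
              regroup = solve-∀
  ... | no d≰q+b = centre-mono (λ s → s) bound′ (absorb (d ∸ (q + b)) (centre-within-x C) (cast length≡ x⇝w))
    where
      c : ℕ
      c = q + b
      length≡ : d ≡ c + (d ∸ c)
      length≡ = sym (m+[n∸m]≡n (<⇒≤ (≰⇒> d≰q+b)))
      bound′ : 2 * c + (d ∸ c) ≤ B + M
      bound′ = begin
        2 * c + (d ∸ c)   ≡⟨ trans (cong (_+ (d ∸ c)) (regroup c)) (+-assoc c c (d ∸ c)) ⟩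
        c + (c + (d ∸ c)) ≡⟨ cong (c +_) (sym length≡) ⟩
        q + b + d         ≤⟨ +-monoʳ-≤ (q + b) d≤q+M ⟩
        q + b + (q + M)   ≡⟨ regroup′ q b M ⟩
        2 * q + b + M     ≤⟨ +-monoˡ-≤ M bound ⟩
        B + M             ∎
        where open ≤-Reasoning
              regroup : ∀ c → 2 * c ≡ c + c
              regroup = solve-∀
              regroup′ : ∀ q b M → q + b + (q + M) ≡ 2 * q + b + M
              regroup′ = solve-∀

module Domination {n : ℕ} (G : Graph n) (connected : Connected G) (k : ℕ)
                  (D : Subset n) (dominating : IsDistKDominating G k D) where
  open Walks G
  open Centres G

  M : ℕ
  M = 2 * k + 1

  dominator : ∀ v → Σ (Fin n) λ w → w ∈ D × Within w v k
  dominator v with v ∈? D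
  ... | yes v∈D = v , v∈D , within-refl k
  ... | no v∉D with dominating v v∉D
  ... | w , w∈D , m , (v⇝w , _) , m≤k = w , w∈D , m , reverse (fromWalk v⇝w) , m≤k

  DominatedFrom : Subset n → Fin n → Set
  DominatedFrom S a = Σ (Fin n) λ p → p ∈ S × Within p a k

  record Bridge (S : Subset n) : Set where
    field
      {from to} : Fin n
      from∈S    : from ∈ S
      to∈D      : to ∈ D
      to∉S      : to ∉ S
      near      : Within from to M

  -- the first vertex of the walk whose dominator lies outside S yields the bridge
  bridge-along : ∀ {S a b m} → Walk′ a b m → DominatedFrom S a → DominatedFrom S b ⊎ Bridge S
  bridge-along (stay _) dom-a = inj₁ dom-a
  bridge-along {S} (move _ a∼a′ rest) (p , p∈S , p-a) with dominator _
  ... | w , w∈D , w-a′ with w ∈? S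
  ...   | yes w∈S = bridge-along rest (w , w∈S , w-a′)
  ...   | no w∉S = inj₂ record
          { from∈S = p∈S ; to∈D = w∈D ; to∉S = w∉S
          ; near = within-mono (≤-reflexive (k+1+k≡M k))
                     (within-trans (within-trans p-a (edge⇒within a∼a′)) (within-sym w-a′)) }
    where k+1+k≡M : ∀ k → k + 1 + k ≡ 2 * k + 1
          k+1+k≡M = solve-∀

  bridge : ∀ {S p w} → p ∈ S → w ∈ D → w ∉ S → Bridge S
  bridge {S} {p} {w} p∈S w∈D w∉S with bridge-along (fromWalk (proj₂ (connected p w))) (p , p∈S , within-refl k)
  ... | inj₂ β = β
  ... | inj₁ (p′ , p′∈S , p′-w) = record
          { from∈S = p′∈S ; to∈D = w∈D ; to∉S = w∉S ; near = within-mono k≤M p′-w }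
    where k≤M : k ≤ M
          k≤M = ≤-trans (m≤m+n k (k + 1)) (≤-reflexive (k+[k+1]≡M k))
            where k+[k+1]≡M : ∀ k → k + (k + 1) ≡ 2 * k + 1
                  k+[k+1]≡M = solve-∀

  private
    ∈∪⁅⁆⁻ : ∀ {S : Subset n} {v} w → v ∈ S ∪ ⁅ w ⁆ → v ∈ S ⊎ v ≡ w
    ∈∪⁅⁆⁻ {S} w v∈ with x∈p∪q⁻ S ⁅ w ⁆ v∈
    ... | inj₁ v∈S = inj₁ v∈S
    ... | inj₂ v∈⁅w⁆ = inj₂ (x∈⁅y⁆⇒x≡y w v∈⁅w⁆)

    1≤M : 1 ≤ M
    1≤M = m≤n+m 1 (2 * k)

  extend-by : ∀ {S B} → Centre (_∈ S) B → (β : Bridge S) → Centre (_∈ S ∪ ⁅ Bridge.to β ⁆) (B + M)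
  extend-by C@(centre link covers bound) β with covers _ (Bridge.from∈S β)
  ... | inj₁ x-from = centre-mono (∈∪⁅⁆⁻ _) ≤-refl (extend 1≤M C (within-trans x-from (Bridge.near β)))
  ... | inj₂ y-from = centre-mono (∈∪⁅⁆⁻ _) ≤-refl (extend 1≤M (centre-swap C) (within-trans y-from (Bridge.near β)))

  grow : ∀ fuel (S : Subset n) {s p} → ∣ D ∣ ≤ ∣ S ∣ + fuel → S ⊆ D → suc s ≤ ∣ S ∣ → p ∈ S →
         Centre (_∈ S) (M * s) → Σ ℕ λ s′ → suc s′ ≤ ∣ D ∣ × Centre (_∈ D) (M * s′)
  grow fuel S {s} {p} ∣D∣≤ S⊆D s<∣S∣ p∈S C with any? (λ w → (w ∈? D) ×-dec ¬? (w ∈? S))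
  ... | no ∄w = s , ≤-trans s<∣S∣ (p⊆q⇒∣p∣≤∣q∣ S⊆D) , centre-mono D⊆S ≤-refl C
    where
      D⊆S : D ⊆ S
      D⊆S {w} w∈D with w ∈? S
      ... | yes w∈S = w∈S
      ... | no w∉S = contradiction (w , w∈D , w∉S) ∄w
  ... | yes (w , w∈D , w∉S) = continue fuel ∣D∣≤
    where
      β : Bridge S
      β = bridge p∈S w∈D w∉S
      S′ : Subset n
      S′ = S ∪ ⁅ Bridge.to β ⁆
      S′⊆D : S′ ⊆ D
      S′⊆D v∈S′ with ∈∪⁅⁆⁻ _ v∈S′
      ... | inj₁ v∈S = S⊆D v∈S
      ... | inj₂ refl = Bridge.to∈D β
      ∣S∣<∣S′∣ : ∣ S ∣ < ∣ S′ ∣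
      ∣S∣<∣S′∣ = p⊂q⇒∣p∣<∣q∣ (p⊆p∪q _ , Bridge.to β , q⊆p∪q S _ (x∈⁅x⁆ _) , Bridge.to∉S β)
      continue : ∀ fuel → ∣ D ∣ ≤ ∣ S ∣ + fuel → Σ ℕ λ s′ → suc s′ ≤ ∣ D ∣ × Centre (_∈ D) (M * s′)
      continue zero ∣D∣≤∣S∣+0 =
        contradiction (≤-trans ∣S∣<∣S′∣ (≤-trans (p⊆q⇒∣p∣≤∣q∣ S′⊆D) (≤-trans ∣D∣≤∣S∣+0 (≤-reflexive (+-identityʳ _))))) (<-irrefl refl)
      continue (suc fuel) ∣D∣≤ = grow fuel S′
        (≤-trans ∣D∣≤ (≤-trans (≤-reflexive (+-suc ∣ S ∣ fuel)) (+-monoˡ-≤ fuel ∣S∣<∣S′∣)))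
        S′⊆D (≤-trans (s≤s s<∣S∣) ∣S∣<∣S′∣) (p⊆p∪q _ p∈S)
        (centre-mono (λ v∈ → v∈) (≤-reflexive (trans (+-comm (M * s) M) (sym (*-suc M s)))) (extend-by C β))

  dominated-covering : ∀ {B} → Centre (_∈ D) B → Centre (λ _ → ⊤) (B + 2 * k)
  dominated-covering {B} (centre {b = b} {q} link covers bound) = centre link covers′ bound′
    where
      covers′ : ∀ v → ⊤ → Within _ v (q + k) ⊎ Within _ v (q + k)
      covers′ v _ with dominator v
      ... | w , w∈D , w-v with covers w w∈D
      ...   | inj₁ x-w = inj₁ (within-trans x-w w-v)
      ...   | inj₂ y-w = inj₂ (within-trans y-w w-v)
      bound′ : 2 * (q + k) + b ≤ B + 2 * k
      bound′ = ≤-trans (≤-reflexive (regroup q k b)) (+-monoˡ-≤ (2 * k) bound)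
        where regroup : ∀ q k b → 2 * (q + k) + b ≡ 2 * q + b + 2 * k
              regroup = solve-∀

  covering : Fin n → Σ ℕ λ B → Centre (λ _ → ⊤) B × B + 1 ≤ M * ∣ D ∣
  covering v₀ with dominator v₀
  ... | w₀ , w₀∈D , _ with grow ∣ D ∣ ⁅ w₀ ⁆ (m≤n+m _ _) ⁅w₀⁆⊆D (≤-reflexive (sym (∣⁅x⁆∣≡1 w₀))) (x∈⁅x⁆ w₀) C₀
    where
      ⁅w₀⁆⊆D : ⁅ w₀ ⁆ ⊆ D
      ⁅w₀⁆⊆D v∈ rewrite x∈⁅y⁆⇒x≡y w₀ v∈ = w₀∈D
      C₀ : Centre (_∈ ⁅ w₀ ⁆) (M * 0)
      C₀ = centre (inj₁ (refl , refl)) (λ v v∈ → inj₁ (subst (λ u → Within w₀ u 0) (sym (x∈⁅y⁆⇒x≡y w₀ v∈)) (within-refl 0))) z≤n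
  ... | s , s<∣D∣ , C = M * s + 2 * k , dominated-covering C , (begin
      M * s + 2 * k + 1 ≡⟨ regroup (M * s) k ⟩
      M * s + M         ≡⟨ trans (+-comm (M * s) M) (sym (*-suc M s)) ⟩
      M * suc s         ≤⟨ *-monoʳ-≤ M s<∣D∣ ⟩
      M * ∣ D ∣         ∎)
    where open ≤-Reasoning
          regroup : ∀ a k → a + 2 * k + 1 ≡ a + (2 * k + 1)
          regroup = solve-∀

-- Short cycles near a centre

last-or-inject₁ : ∀ {m} (i : Fin (suc m)) → i ≡ fromℕ m ⊎ Σ (Fin m) λ j → i ≡ inject₁ j
last-or-inject₁ {zero} zero = inj₁ refl
last-or-inject₁ {suc m} zero = inj₂ (zero , refl)
last-or-inject₁ {suc m} (suc i) with last-or-inject₁ i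
... | inj₁ refl = inj₁ refl
... | inj₂ (j , refl) = inj₂ (suc j , refl)

module CycleNeighbours {n m : ℕ} {G : Graph n} (C : Cycle G m) where
  open Walks G
  open Cycle C

  next : Fin (suc m) → Fin (suc m)
  next i with last-or-inject₁ i
  ... | inj₁ _ = zero
  ... | inj₂ (j , _) = suc j

  prev : Fin (suc m) → Fin (suc m)
  prev zero = fromℕ m
  prev (suc j) = inject₁ j

  next-∼ : ∀ i → vs i ∼ vs (next i)
  next-∼ i with last-or-inject₁ i
  ... | inj₁ refl = close
  ... | inj₂ (j , refl) = step j

  prev-∼ : ∀ i → vs (prev i) ∼ vs i
  prev-∼ zero = close
  prev-∼ (suc j) = step j

  private
    toℕ-next : ∀ i → (toℕ i ≡ m × toℕ (next i) ≡ 0) ⊎ toℕ (next i) ≡ suc (toℕ i)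
    toℕ-next i with last-or-inject₁ i
    ... | inj₁ refl = inj₁ (toℕ-fromℕ m , refl)
    ... | inj₂ (j , refl) = inj₂ (cong suc (sym (toℕ-inject₁ j)))

    toℕ-prev : ∀ i → (toℕ i ≡ 0 × toℕ (prev i) ≡ m) ⊎ toℕ i ≡ suc (toℕ (prev i))
    toℕ-prev zero = inj₁ (refl , toℕ-fromℕ m)
    toℕ-prev (suc j) = inj₂ (cong suc (sym (toℕ-inject₁ j)))

    a≢1+a : ∀ {a} → a ≢ suc a
    a≢1+a {a} eq = <-irrefl eq (n<1+n a)

    a≢2+a : ∀ {a} → a ≢ suc (suc a)
    a≢2+a {a} eq = <-irrefl eq (m<n⇒m<1+n (n<1+n a))

  module _ (2≤m : 2 ≤ m) where
    private
      m≢0 : m ≢ 0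
      m≢0 m≡0 = <⇒≱ (s≤s z≤n) (≤-trans 2≤m (≤-reflexive m≡0))

      m≢1 : m ≢ 1
      m≢1 m≡1 = <⇒≱ ≤-refl (≤-trans 2≤m (≤-reflexive m≡1))

    next≢ : ∀ i → next i ≢ i
    next≢ i eq with toℕ-next i | cong toℕ eq
    ... | inj₁ (i≡m , next≡0) | e = m≢0 (trans (sym i≡m) (trans (sym e) next≡0))
    ... | inj₂ next≡1+i | e = a≢1+a (trans (sym e) next≡1+i)

    prev≢ : ∀ i → prev i ≢ i
    prev≢ i eq with toℕ-prev i | cong toℕ eq
    ... | inj₁ (i≡0 , prev≡m) | e = m≢0 (trans (sym prev≡m) (trans e i≡0))
    ... | inj₂ i≡1+prev | e = a≢1+a (trans e i≡1+prev)

    prev≢next : ∀ i → prev i ≢ next i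
    prev≢next i eq with toℕ-prev i | toℕ-next i | cong toℕ eq
    ... | inj₁ (i≡0 , _) | inj₁ (i≡m , _) | _ = m≢0 (trans (sym i≡m) i≡0)
    ... | inj₁ (i≡0 , prev≡m) | inj₂ next≡1+i | e = m≢1 (trans (sym prev≡m) (trans e (trans next≡1+i (cong suc i≡0))))
    ... | inj₂ i≡1+prev | inj₁ (i≡m , next≡0) | e = m≢1 (trans (sym i≡m) (trans i≡1+prev (cong suc (trans e next≡0))))
    ... | inj₂ i≡1+prev | inj₂ next≡1+i | e = a≢2+a (trans e (trans next≡1+i (cong suc i≡1+prev)))

module Levels {n : ℕ} (G : Graph n) (connected : Connected G) {x y : Fin n} {b : ℕ}
              (link : Centres.Link G x y b) where
  open Walks G
  open Paths G
  open Distance G connected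
  open Centres G

  level : Fin n → ℕ
  level v = dist x v ⊓ dist y v

  Root : Fin n → Set
  Root v = v ≡ x ⊎ v ≡ y

  level-x : level x ≡ 0
  level-x = n≤0⇒n≡0 (≤-trans (m⊓n≤m _ _) (dist-minimal (stay tt)))

  level-y : level y ≡ 0
  level-y = n≤0⇒n≡0 (≤-trans (m⊓n≤n _ _) (dist-minimal (stay tt)))

  level≡0⇒root : ∀ v → level v ≡ 0 → Root v
  level≡0⇒root v level≡0 with ⊓-sel (dist x v) (dist y v)
  ... | inj₁ e = inj₁ (sym (length0⇒≡ (cast (trans (sym e) level≡0) (dist-walk x v))))
  ... | inj₂ e = inj₂ (sym (length0⇒≡ (cast (trans (sym e) level≡0) (dist-walk y v))))

  private
    side : ∀ {v} → Root v → Fin 2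
    side (inj₁ _) = zero
    side (inj₂ _) = suc zero

    same-side⇒≡ : ∀ {u v} (ru : Root u) (rv : Root v) → side ru ≡ side rv → u ≡ v
    same-side⇒≡ (inj₁ refl) (inj₁ refl) _ = refl
    same-side⇒≡ (inj₂ refl) (inj₂ refl) _ = refl

  ¬injective-into-roots : ∀ {m} (f : Fin (3 + m) → Fin n) → Injective _≡_ _≡_ f → ¬ (∀ j → Root (f j))
  ¬injective-into-roots f f-inj roots with pigeonhole (s≤s (s≤s (s≤s z≤n))) (λ j → side (roots j))
  ... | i , j , i<j , same = <-irrefl (cong toℕ (f-inj (same-side⇒≡ (roots i) (roots j) same))) i<j

  private
    closer : ∀ a v {d} → Walk′ a v d → 0 < d → Σ (Fin n) λ p → v ∼ p × dist a p < d
    closer a v {suc d} a⇝v _ with reverse a⇝v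
    ... | move _ v∼p p⇝a = _ , v∼p , s≤s (dist-minimal (reverse p⇝a))

  level-descent : ∀ v → 0 < level v → Σ (Fin n) λ p → v ∼ p × level p < level v
  level-descent v 0<level with ⊓-sel (dist x v) (dist y v)
  ... | inj₁ e with closer x v (dist-walk x v) (subst (0 <_) e 0<level)
  ...   | p , v∼p , <d = p , v∼p , subst (level p <_) (sym e) (≤-<-trans (m⊓n≤m _ _) <d)
  level-descent v 0<level | inj₂ e with closer y v (dist-walk y v) (subst (0 <_) e 0<level)
  ...   | p , v∼p , <d = p , v∼p , subst (level p <_) (sym e) (≤-<-trans (m⊓n≤n _ _) <d)

  descend : ∀ v → Σ (Fin n) λ r → Root r × Σ ℕ λ ℓ → ℓ ≤ level v × WalkIn (λ z → level z ≤ level v) v r ℓ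
  descend v = go (level v) v ≤-refl
    where
      go : ∀ fuel v → level v ≤ fuel → Σ (Fin n) λ r → Root r × Σ ℕ λ ℓ → ℓ ≤ level v × WalkIn (λ z → level z ≤ level v) v r ℓ
      go fuel v ≤fuel with level v ≟ 0
      ... | yes level≡0 = v , level≡0⇒root v level≡0 , 0 , z≤n , stay ≤-refl
      go zero v ≤0 | no level≢0 = contradiction (n≤0⇒n≡0 ≤0) level≢0
      go (suc fuel) v ≤fuel | no level≢0 with level-descent v (n≢0⇒n>0 level≢0)
      ... | p , v∼p , p<v with go fuel p (≤-pred (≤-trans p<v ≤fuel))
      ...   | r , root , ℓ , ℓ≤ , p⇝r = r , root , suc ℓ , ≤-trans (s≤s ℓ≤) p<v ,
              move ≤-refl v∼p (mapWalkIn (λ z≤p → ≤-trans z≤p (<⇒≤ p<v)) p⇝r)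

  module _ (h : ℕ) (0<h : 0 < h) where

    Below : Fin n → Set
    Below z = level z < h

    private
      x-below : Below x
      x-below = subst (_< h) (sym level-x) 0<h

      y-below : Below y
      y-below = subst (_< h) (sym level-y) 0<h

      link-walk : ∀ {b} → Link x y b → WalkIn Below x y b
      link-walk (inj₁ (refl , refl)) = stay x-below
      link-walk (inj₂ (refl , x∼y)) = move x-below x∼y (stay y-below)

      root-walk : ∀ {r r′} → Root r → Root r′ → Σ ℕ λ ℓ → ℓ ≤ b × WalkIn Below r r′ ℓ
      root-walk (inj₁ refl) (inj₁ refl) = 0 , z≤n , stay x-below
      root-walk (inj₂ refl) (inj₂ refl) = 0 , z≤n , stay y-below
      root-walk (inj₁ refl) (inj₂ refl) = b , ≤-refl , link-walk link
      root-walk (inj₂ refl) (inj₁ refl) = b , ≤-refl , reverse (link-walk link)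

    path-below : ∀ u v → Below u → Below v →
                 Σ ℕ λ ℓ → ℓ ≤ level u + (b + level v) × Σ (WalkIn Below u v ℓ) IsPath
    path-below u v u-below v-below with descend u | descend v
    ... | r , r-root , ℓ , ℓ≤ , u⇝r | r′ , r′-root , ℓ′ , ℓ′≤ , v⇝r′ with root-walk r-root r′-root
    ...   | ℓ″ , ℓ″≤b , r⇝r′ with shortest (λ z → suc (level z) ≤? h) u⇝v
      where u⇝v : WalkIn Below u v (ℓ + (ℓ″ + ℓ′))
            u⇝v = mapWalkIn (λ ≤u → ≤-<-trans ≤u u-below) u⇝r ++ r⇝r′ ++ reverse (mapWalkIn (λ ≤v → ≤-<-trans ≤v v-below) v⇝r′)
    ... | m , m≤ , π , minimal = m , ≤-trans m≤ (+-mono-≤ ℓ≤ (+-mono-≤ ℓ″≤b ℓ′≤)) , π , shortest⇒isPath π minimal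

    avoids : ∀ {u v ℓ} (π : WalkIn Below u v ℓ) {c} → h ≤ level c → ∀ i → vertex (forget π) i ≢ c
    avoids π h≤c i refl = <⇒≱ (subst Below (sym (vertex-forget π i)) (vertex-P π i)) h≤c

  module _ {R : ℕ} (covers : ∀ v → Within x v R ⊎ Within y v R) where

    level≤R : ∀ v → level v ≤ R
    level≤R v with covers v
    ... | inj₁ x-v = ≤-trans (m⊓n≤m _ _) (within⇒dist≤ x-v)
    ... | inj₂ y-v = ≤-trans (m⊓n≤n _ _) (within⇒dist≤ y-v)

    ShortCycle : Set
    ShortCycle = Σ ℕ λ L → HasCycleOfLength G L × L ≤ R + b + R + 1

    private
      3+ℓ≤ : ∀ {ℓ p a} → ℓ ≤ p + (b + a) → p < R → a < R → 3 + ℓ ≤ R + b + R + 1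
      3+ℓ≤ {ℓ} {p} {a} ℓ≤ p<R a<R = begin
        3 + ℓ                 ≤⟨ +-monoʳ-≤ 3 ℓ≤ ⟩
        3 + (p + (b + a))     ≡⟨ regroup p b a ⟩
        suc p + b + suc a + 1 ≤⟨ +-monoˡ-≤ 1 (+-mono-≤ (+-monoˡ-≤ b p<R) a<R) ⟩
        R + b + R + 1         ∎
        where open ≤-Reasoning
              regroup : ∀ p b a → 3 + (p + (b + a)) ≡ suc p + b + suc a + 1
              regroup = solve-∀

    cycle-through-edge : ∀ {c c′} → c ∼ c′ → c ≢ c′ → level c′ ≡ level c → 0 < level c → ShortCycle
    cycle-through-edge {c} {c′} c∼c′ c≢c′ same-level 0<h
      with level-descent c 0<h | level-descent c′ (subst (0 <_) (sym same-level) 0<h)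
    ... | a , c∼a , a<h | a′ , c′∼a′ , a′<c′ = close (subst (level a′ <_) same-level a′<c′)
      where
        close : level a′ < level c → ShortCycle
        close a′<h with path-below (level c) 0<h a′ a a′<h a<h
        ... | ℓ , ℓ≤ , π , π-path =
              _ , path+edge⇒cycle c⇝a c⇝a-path (s≤s (s≤s z≤n)) (∼-sym c∼a) ,
              3+ℓ≤ ℓ≤ (≤-trans a′<h (level≤R c)) (≤-trans a<h (level≤R c))
          where
            c⇝a : Walk′ c a (suc (suc ℓ))
            c⇝a = move tt c∼c′ (move tt c′∼a′ (forget π))
            c⇝a-path : IsPath c⇝a
            c⇝a-path = move-isPath tt c∼c′ _
              (move-isPath tt c′∼a′ _ (forget-isPath π π-path) (avoids (level c) 0<h π (≤-reflexive (sym same-level))))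
              λ { zero → λ c′≡c → c≢c′ (sym c′≡c) ; (suc i) → avoids (level c) 0<h π ≤-refl i }

    cycle-through-vertex : ∀ {c⁻ c c⁺} → c⁻ ∼ c → c ∼ c⁺ → c⁺ ≢ c⁻ → level c⁺ < level c → level c⁻ < level c → ShortCycle
    cycle-through-vertex {c⁻} {c} {c⁺} c⁻∼c c∼c⁺ c⁺≢c⁻ c⁺<h c⁻<h = close (≤-trans (s≤s z≤n) c⁺<h)
      where
        close : 0 < level c → ShortCycle
        close 0<h with path-below (level c) 0<h c⁺ c⁻ c⁺<h c⁻<h
        ... | zero , _ , π , _ = contradiction (length0⇒≡ π) c⁺≢c⁻
        ... | suc ℓ , ℓ≤ , π , π-path =
              _ , path+edge⇒cycle c⇝c⁻ c⇝c⁻-path (s≤s (s≤s z≤n)) c⁻∼c ,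
              ≤-trans (n≤1+n _) (3+ℓ≤ ℓ≤ (≤-trans c⁺<h (level≤R c)) (≤-trans c⁻<h (level≤R c)))
          where
            c⇝c⁻ : Walk′ c c⁻ (suc (suc ℓ))
            c⇝c⁻ = move tt c∼c⁺ (forget π)
            c⇝c⁻-path : IsPath c⇝c⁻
            c⇝c⁻-path = move-isPath tt c∼c⁺ _ (forget-isPath π π-path) (avoids (level c) 0<h π ≤-refl)

    module _ {m} (C : Cycle G (suc (suc m))) where
      open Cycle C
      open CycleNeighbours C

      private
        2≤m : 2 ≤ suc (suc m)
        2≤m = s≤s (s≤s z≤n)

        max-level-positive : ∀ i → (∀ j → level (vs j) ≤ level (vs i)) → 0 < level (vs i)
        max-level-positive i i-max with level (vs i) ≟ 0
        ... | no level≢0 = n≢0⇒n>0 level≢0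
        ... | yes level≡0 = contradiction (λ j → level≡0⇒root (vs j) (n≤0⇒n≡0 (≤-trans (i-max j) (≤-reflexive level≡0))))
                                          (¬injective-into-roots vs inj)

      cycle-around-max : ∀ i → (∀ j → level (vs j) ≤ level (vs i)) → ShortCycle
      cycle-around-max i i-max with level (vs (next i)) ≟ level (vs i) | level (vs (prev i)) ≟ level (vs i)
      ... | yes same | _ = cycle-through-edge (next-∼ i) (λ eq → next≢ 2≤m i (inj (sym eq))) same (max-level-positive i i-max)
      ... | no _ | yes same = cycle-through-edge (∼-sym (prev-∼ i)) (λ eq → prev≢ 2≤m i (inj (sym eq))) same (max-level-positive i i-max)
      ... | no ≢⁺ | no ≢⁻ = cycle-through-vertex (prev-∼ i) (next-∼ i) (λ eq → prev≢next 2≤m i (inj (sym eq)))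
                              (≤∧≢⇒< (i-max (next i)) ≢⁺) (≤∧≢⇒< (i-max (prev i)) ≢⁻)

      cycle-bound : ShortCycle
      cycle-bound with argmax zero (λ j → level (vs j))
      ... | i , i-max = cycle-around-max i i-max

    girth-bound : ∀ {g} → IsGirth G g → g ≤ R + b + R + 1
    girth-bound ((m , g≡1+m , 3≤g , C) , minimal) with long-cycle-bound (subst (3 ≤_) g≡1+m 3≤g) C
      where
        long-cycle-bound : ∀ {m} → 3 ≤ suc m → Cycle G m → ShortCycle
        long-cycle-bound {suc (suc m)} _ C = cycle-bound C
        long-cycle-bound {0} (s≤s ())
        long-cycle-bound {1} (s≤s (s≤s ()))
    ... | L , L-cycle , L≤ = ≤-trans (minimal L L-cycle) L≤

module CoveringBounds {n : ℕ} (G : Graph n) (connected : Connected G) {B : ℕ}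
                      (C : Centres.Centre G (λ _ → ⊤) B) where
  open Walks G
  open Distance G connected
  open Centres G
  open Centre C

  private
    covers′ : ∀ v → Within x v q ⊎ Within y v q
    covers′ v = covers v tt

  within-span : ∀ u v → Within u v (q + b + q)
  within-span u v with covers′ u | covers′ v
  ... | inj₁ x-u | inj₁ x-v = within-mono (+-monoˡ-≤ q (m≤m+n q b)) (within-trans (within-sym x-u) x-v)
  ... | inj₁ x-u | inj₂ y-v = within-trans (within-trans (within-sym x-u) (link⇒within link)) y-v
  ... | inj₂ y-u | inj₁ x-v = within-trans (within-trans (within-sym y-u) (link⇒within (link-sym link))) x-v
  ... | inj₂ y-u | inj₂ y-v = within-mono (+-monoˡ-≤ q (m≤m+n q b)) (within-trans (within-sym y-u) y-v)

  private
    span≡ : q + b + q + 1 ≡ 2 * q + b + 1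
    span≡ = regroup q b
      where regroup : ∀ q b → q + b + q + 1 ≡ 2 * q + b + 1
            regroup = solve-∀

  diameter≤span : ∀ {d} → IsDiameter G d → d ≤ B
  diameter≤span ((v , (u , (_ , minimal)) , _) , _) with within-span v u
  ... | m , v⇝u , m≤ = ≤-trans (minimal m (toWalk v⇝u)) (+-cancelʳ-≤ 1 _ _ (≤-trans (+-monoˡ-≤ 1 m≤) (≤-trans (≤-reflexive span≡) (+-monoˡ-≤ 1 bound))))

  radius≤span : ∀ {r} → IsRadius G r → 2 * r ≤ B + 1
  radius≤span {r} (_ , minimal) with eccentricity≤ x (q + b) (λ u → centre-within-x C u tt)
  ... | e , x-ecc , e≤ = begin
    2 * r           ≤⟨ *-monoʳ-≤ 2 (≤-trans (minimal x e x-ecc) e≤) ⟩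
    2 * (q + b)     ≡⟨ regroup q b ⟩
    2 * q + b + b   ≤⟨ +-mono-≤ bound (link≤1 link) ⟩
    B + 1           ∎
    where open ≤-Reasoning
          regroup : ∀ q b → 2 * (q + b) ≡ 2 * q + b + b
          regroup = solve-∀

  girth≤span+1 : ∀ {g} → IsGirth G g → g ≤ B + 1
  girth≤span+1 g-girth = ≤-trans (Levels.girth-bound G connected link covers′ g-girth)
                                   (≤-trans (≤-reflexive span≡) (+-monoˡ-≤ 1 bound))

module DominationBounds {n : ℕ} (G : Graph n) (connected : Connected G) (k : ℕ)
                        (D : Subset n) (dominating : IsDistKDominating G k D) (v₀ : Fin n) where
  open Domination G connected k D dominating using (covering)

  private
    span : ℕ
    span = proj₁ (covering v₀)

    centre₀ : Centres.Centre G (λ _ → ⊤) span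
    centre₀ = proj₁ (proj₂ (covering v₀))

    span+1≤ : span + 1 ≤ (2 * k + 1) * ∣ D ∣
    span+1≤ = proj₂ (proj₂ (covering v₀))

    open CoveringBounds G connected centre₀

  diameter-bound : ∀ {d} → IsDiameter G d → d + 1 ≤ (2 * k + 1) * ∣ D ∣
  diameter-bound d-diam = ≤-trans (+-monoˡ-≤ 1 (diameter≤span d-diam)) span+1≤

  radius-bound : ∀ {r} → IsRadius G r → 2 * r ≤ (2 * k + 1) * ∣ D ∣
  radius-bound r-rad = ≤-trans (radius≤span r-rad) span+1≤

  girth-bound : ∀ {g} → IsGirth G g → g ≤ (2 * k + 1) * ∣ D ∣
  girth-bound g-girth = ≤-trans (girth≤span+1 g-girth) span+1≤

isGammaRK-from-bound : ∀ {n} {G : Graph n} {k} c {X} (D : Subset n) →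
                       IsResolvingDistKDominating G k D → ∣ D ∣ ≡ suc c → (2 * k + 1) * c < X →
                       (∀ D′ → IsDistKDominating G k D′ → X ≤ (2 * k + 1) * ∣ D′ ∣) → IsGammaRK G k (suc c)
isGammaRK-from-bound {k = k} c D D-rd ∣D∣≡ Mc<X X≤ =
  (D , D-rd , ∣D∣≡) , λ D′ D′-rd → *-cancelˡ-< (2 * k + 1) c ∣ D′ ∣ (≤-trans Mc<X (X≤ D′ (proj₂ D′-rd)))

-- Paths and cycles

module RelationGraph {N : ℕ} (R : Fin N → Fin N → Set) (R? : ∀ i j → Dec (R i j))
                     (R-sym : ∀ {i j} → R i j → R j i) (R-irrefl : ∀ {i} → ¬ R i i) where

  graph : Graph N
  graph = record
    { adj    = λ i j → isYes (R? i j)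
    ; sym    = λ i j → isYes-sym (R? i j) (R? j i)
    ; irrefl = λ i e → R-irrefl (toWitness e) }
    where
      isYes-sym : ∀ {i j} (d : Dec (R i j)) (d′ : Dec (R j i)) → isYes d ≡ isYes d′
      isYes-sym (yes _) (yes _) = refl
      isYes-sym (no _) (no _) = refl
      isYes-sym (yes r) (no ¬r) = contradiction (R-sym r) ¬r
      isYes-sym (no ¬r) (yes r) = contradiction (R-sym r) ¬r

  edge⇒R : ∀ {i j} → Edge graph i j → R i j
  edge⇒R = toWitness

  R⇒edge : ∀ {i j} → R i j → Edge graph i j
  R⇒edge = fromWitness

∣p∪⁅x⁆∣≡1+∣p∣ : ∀ {n} (p : Subset n) x → x ∉ p → ∣ p ∪ ⁅ x ⁆ ∣ ≡ suc ∣ p ∣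
∣p∪⁅x⁆∣≡1+∣p∣ (false ∷ p) zero    x∉p = cong suc (cong ∣_∣ (∪-identityʳ p))
∣p∪⁅x⁆∣≡1+∣p∣ (true ∷ p)  zero    x∉p = contradiction here x∉p
∣p∪⁅x⁆∣≡1+∣p∣ (false ∷ p) (suc x) x∉p = ∣p∪⁅x⁆∣≡1+∣p∣ p x (λ x∈p → x∉p (there x∈p))
∣p∪⁅x⁆∣≡1+∣p∣ (true ∷ p)  (suc x) x∉p = cong suc (∣p∪⁅x⁆∣≡1+∣p∣ p x (λ x∈p → x∉p (there x∈p)))

module ExactDistance {N : ℕ} (G : Graph N) (f : Fin N → Fin N → ℕ)
                     (f-walk : ∀ i j → Walks.Walk′ G i j (f i j))
                     (f-self : ∀ j → f j j ≡ 0)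
                     (f-step : ∀ {i i′} j → Edge G i i′ → f i j ≤ suc (f i′ j)) where
  open Walks G

  f≤length : ∀ {i j m} → Walk′ i j m → f i j ≤ m
  f≤length {i} (stay _) = ≤-reflexive (f-self i)
  f≤length (move _ e w) = ≤-trans (f-step _ e) (s≤s (f≤length w))

  f-Dist : ∀ i j → Dist G i j (f i j)
  f-Dist i j = toWalk (f-walk i j) , λ _ w → f≤length (fromWalk w)

  Dist⇒≡f : ∀ {i j m} → Dist G i j m → m ≡ f i j
  Dist⇒≡f {i} {j} (w , minimal) = ≤-antisym (minimal _ (toWalk (f-walk i j))) (f≤length (fromWalk w))

  connected : Connected G
  connected i j = _ , toWalk (f-walk i j)

  f-isEcc : ∀ {v e} u → f v u ≡ e → (∀ u → f v u ≤ e) → IsEcc G v e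
  f-isEcc {v} u f≡e f≤e = (u , subst (Dist G v u) f≡e (f-Dist v u)) , λ u′ m d → subst (_≤ _) (sym (Dist⇒≡f d)) (f≤e u′)

  isEcc⇒f≤ : ∀ {v e} → IsEcc G v e → ∀ u → f v u ≤ e
  isEcc⇒f≤ {v} (_ , ecc-max) u = ecc-max u _ (f-Dist v u)

module ConsecutiveWalks {N : ℕ} (G : Graph N) (succ-edge : ∀ {i j} → suc (toℕ i) ≡ toℕ j → Edge G i j) where
  open Walks G

  private
    walk-up : ∀ (i : Fin N) d → toℕ i + d < N → Σ (Fin N) λ j → toℕ j ≡ toℕ i + d × Walk′ i j d
    walk-up i zero _ = i , sym (+-identityʳ _) , stay tt
    walk-up i (suc d) i+[1+d]<N with walk-up (fromℕ< i+1<N) d i′+d<N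
      where
        i+1+d<N : suc (toℕ i) + d < N
        i+1+d<N = subst (_< N) (+-suc (toℕ i) d) i+[1+d]<N
        i+1<N : suc (toℕ i) < N
        i+1<N = ≤-<-trans (m≤m+n (suc (toℕ i)) d) i+1+d<N
        i′+d<N : toℕ (fromℕ< i+1<N) + d < N
        i′+d<N = subst (λ z → z + d < N) (sym (toℕ-fromℕ< i+1<N)) i+1+d<N
    ... | j , j≡ , w = j , trans j≡ (trans (cong (_+ d) (toℕ-fromℕ< _)) (sym (+-suc (toℕ i) d))) ,
          move tt (succ-edge (sym (toℕ-fromℕ< _))) w

  forward-walk : ∀ i j → toℕ i ≤ toℕ j → Walk′ i j (toℕ j ∸ toℕ i)
  forward-walk i j i≤j with walk-up i (toℕ j ∸ toℕ i) (subst (_< N) (sym (m+[n∸m]≡n i≤j)) (toℕ<n j))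
  ... | j′ , j′≡ , w = subst (λ z → Walk′ i z _) (toℕ-injective (trans j′≡ (m+[n∸m]≡n i≤j))) w

  ∣-∣-walk : ∀ i j → Walk′ i j ∣ toℕ i - toℕ j ∣
  ∣-∣-walk i j with ≤-total (toℕ i) (toℕ j)
  ... | inj₁ i≤j = cast (sym (m≤n⇒∣m-n∣≡n∸m i≤j)) (forward-walk i j i≤j)
  ... | inj₂ j≤i = cast (sym (m≤n⇒∣n-m∣≡n∸m j≤i)) (reverse (forward-walk j i j≤i))

∣-∣-split : ∀ a b → (b ≤ a × ∣ a - b ∣ + b ≡ a) ⊎ (a ≤ b × ∣ a - b ∣ + a ≡ b)
∣-∣-split a b with ≤-total b a
... | inj₁ b≤a = inj₁ (b≤a , trans (cong (_+ b) (m≤n⇒∣n-m∣≡n∸m b≤a)) (m∸n+n≡m b≤a))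
... | inj₂ a≤b = inj₂ (a≤b , trans (cong (_+ a) (m≤n⇒∣m-n∣≡n∸m a≤b)) (m∸n+n≡m a≤b))

∣m-n∣≡1 : ∀ {m n} → suc m ≡ n ⊎ suc n ≡ m → ∣ m - n ∣ ≡ 1
∣m-n∣≡1 {m} (inj₁ refl) = ∣m-1+m∣≡1 m
  where ∣m-1+m∣≡1 : ∀ m → ∣ m - suc m ∣ ≡ 1
        ∣m-1+m∣≡1 zero = refl
        ∣m-1+m∣≡1 (suc m) = ∣m-1+m∣≡1 m
∣m-n∣≡1 {n = n} (inj₂ refl) = ∣1+n-n∣≡1 n
  where ∣1+n-n∣≡1 : ∀ n → ∣ suc n - n ∣ ≡ 1
        ∣1+n-n∣≡1 zero = refl
        ∣1+n-n∣≡1 (suc n) = ∣1+n-n∣≡1 n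

∣m-o∣≡∣n-o∣⇒m≡n⊎m+n≡o+o : ∀ m n o → ∣ m - o ∣ ≡ ∣ n - o ∣ → m ≡ n ⊎ m + n ≡ o + o
∣m-o∣≡∣n-o∣⇒m≡n⊎m+n≡o+o m n o eq with ∣-∣-split m o | ∣-∣-split n o
... | inj₁ (_ , m≡) | inj₁ (_ , n≡) = inj₁ (trans (sym m≡) (trans (cong (_+ o) eq) n≡))
... | inj₂ (_ , o≡) | inj₂ (_ , o≡′) = inj₁ (+-cancelˡ-≡ ∣ m - o ∣ m n (trans o≡ (trans (sym o≡′) (cong (_+ n) (sym eq)))))
... | inj₁ (_ , m≡) | inj₂ (_ , o≡) = inj₂ (begin
      m + n                 ≡⟨ cong (_+ n) (sym m≡) ⟩
      ∣ m - o ∣ + o + n     ≡⟨ cong (λ z → z + o + n) eq ⟩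
      ∣ n - o ∣ + o + n     ≡⟨ regroup ∣ n - o ∣ o n ⟩
      o + (∣ n - o ∣ + n)   ≡⟨ cong (o +_) o≡ ⟩
      o + o                 ∎)
  where open ≡-Reasoning
        regroup : ∀ a b c → a + b + c ≡ b + (a + c)
        regroup = solve-∀
... | inj₂ (_ , o≡) | inj₁ (_ , n≡) = inj₂ (begin
      m + n                 ≡⟨ cong (m +_) (sym n≡) ⟩
      m + (∣ n - o ∣ + o)   ≡⟨ cong (λ z → m + (z + o)) (sym eq) ⟩
      m + (∣ m - o ∣ + o)   ≡⟨ regroup m ∣ m - o ∣ o ⟩
      (∣ m - o ∣ + m) + o   ≡⟨ cong (_+ o) o≡ ⟩
      o + o                 ∎)
  where open ≡-Reasoning
        regroup : ∀ a b c → a + (b + c) ≡ (b + a) + c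
        regroup = solve-∀

∣m-n∣≤o : ∀ m n o → m ≤ n + o → n ≤ m + o → ∣ m - n ∣ ≤ o
∣m-n∣≤o m n o m≤n+o n≤m+o with ∣-∣-split m n
... | inj₁ (_ , m≡) = +-cancelʳ-≤ n _ o (≤-trans (≤-reflexive m≡) (≤-trans m≤n+o (≤-reflexive (+-comm n o))))
... | inj₂ (_ , n≡) = +-cancelʳ-≤ m _ o (≤-trans (≤-reflexive n≡) (≤-trans n≤m+o (≤-reflexive (+-comm m o))))

o≤∣m-n∣ : ∀ m n o → o + n ≤ m ⊎ o + m ≤ n → o ≤ ∣ m - n ∣
o≤∣m-n∣ m n o o≤ with ∣-∣-split m n | o≤
... | inj₁ (_ , m≡) | inj₁ o+n≤m = +-cancelʳ-≤ n o _ (≤-trans o+n≤m (≤-reflexive (sym m≡)))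
... | inj₂ (_ , n≡) | inj₂ o+m≤n = +-cancelʳ-≤ m o _ (≤-trans o+m≤n (≤-reflexive (sym n≡)))
... | inj₁ (n≤m , _) | inj₂ o+m≤n = ≤-trans (+-cancelʳ-≤ m o 0 (≤-trans o+m≤n n≤m)) z≤n
... | inj₂ (m≤n , _) | inj₁ o+n≤m = ≤-trans (+-cancelʳ-≤ n o 0 (≤-trans o+n≤m m≤n)) z≤n

m+m≡n+n⇒m≡n : ∀ {m n} → m + m ≡ n + n → m ≡ n
m+m≡n+n⇒m≡n {m} {n} eq with <-cmp m n
... | tri≈ _ m≡n _ = m≡n
... | tri< m<n _ _ = contradiction eq (<⇒≢ (+-mono-< m<n m<n))
... | tri> _ _ m>n = contradiction (sym eq) (<⇒≢ (+-mono-< m>n m>n))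

module PathGraph (L : ℕ) where

  Consecutive : Fin (suc L) → Fin (suc L) → Set
  Consecutive i j = suc (toℕ i) ≡ toℕ j ⊎ suc (toℕ j) ≡ toℕ i

  private
    consecutive? : ∀ i j → Dec (Consecutive i j)
    consecutive? i j with suc (toℕ i) ≟ toℕ j | suc (toℕ j) ≟ toℕ i
    ... | yes i+1≡j | _ = yes (inj₁ i+1≡j)
    ... | no _ | yes j+1≡i = yes (inj₂ j+1≡i)
    ... | no i+1≢j | no j+1≢i = no λ { (inj₁ i+1≡j) → i+1≢j i+1≡j ; (inj₂ j+1≡i) → j+1≢i j+1≡i }

    consecutive-sym : ∀ {i j} → Consecutive i j → Consecutive j i
    consecutive-sym = swap

    consecutive-irrefl : ∀ {i} → ¬ Consecutive i i
    consecutive-irrefl (inj₁ eq) = <-irrefl (sym eq) (n<1+n _)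
    consecutive-irrefl (inj₂ eq) = <-irrefl (sym eq) (n<1+n _)

  open RelationGraph Consecutive consecutive? consecutive-sym consecutive-irrefl public
  open Walks graph
  open ConsecutiveWalks graph (λ i+1≡j → R⇒edge (inj₁ i+1≡j))

  pathDist : Fin (suc L) → Fin (suc L) → ℕ
  pathDist i j = ∣ toℕ i - toℕ j ∣

  open ExactDistance graph pathDist ∣-∣-walk (λ j → ∣n-n∣≡0 (toℕ j))
         (λ {i} {i′} j e → ≤-trans (∣-∣-triangle (toℕ i) (toℕ i′) (toℕ j)) (≤-reflexive (cong (_+ _) (∣m-n∣≡1 (edge⇒R e)))))
    public

  pathDist≤L : ∀ i j → pathDist i j ≤ L
  pathDist≤L i j = ≤-trans (∣m-n∣≤m⊔n (toℕ i) (toℕ j)) (⊔-lub (≤-pred (toℕ<n i)) (≤-pred (toℕ<n j)))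

  diameter : IsDiameter graph L
  diameter = (zero , f-isEcc (fromℕ L) (toℕ-fromℕ L) (pathDist≤L zero)) ,
             λ { v e ((u , d) , _) → subst (_≤ L) (sym (Dist⇒≡f d)) (pathDist≤L v u) }

module PathSharpness (k : ℕ) where
  open PathGraph (4 * k + 1)

  private
    L : ℕ
    L = 4 * k + 1

    L≡2k+[2k+1] : L ≡ 2 * k + (2 * k + 1)
    L≡2k+[2k+1] = regroup k
      where regroup : ∀ k → 4 * k + 1 ≡ 2 * k + (2 * k + 1)
            regroup = solve-∀

    L≡[3k+1]+k : L ≡ 3 * k + 1 + k
    L≡[3k+1]+k = regroup k
      where regroup : ∀ k → 4 * k + 1 ≡ 3 * k + 1 + k
            regroup = solve-∀

    node : ∀ a → a ≤ L → Fin (suc L)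
    node a a≤L = fromℕ< (s≤s a≤L)

    toℕ-node : ∀ a (a≤L : a ≤ L) → toℕ (node a a≤L) ≡ a
    toℕ-node a a≤L = toℕ-fromℕ< (s≤s a≤L)

    toℕ≤L : ∀ (u : Fin (suc L)) → toℕ u ≤ L
    toℕ≤L u = ≤-pred (toℕ<n u)

    2k≤L : 2 * k ≤ L
    2k≤L = ≤-trans (m≤m+n (2 * k) (2 * k + 1)) (≤-reflexive (sym L≡2k+[2k+1]))

    abstract
      middle : Fin (suc L)
      middle = node (2 * k) 2k≤L

      toℕ-middle : toℕ middle ≡ 2 * k
      toℕ-middle = toℕ-node (2 * k) 2k≤L

    middle-ecc : ∀ u → pathDist middle u ≤ 2 * k + 1
    middle-ecc u rewrite toℕ-middle =
      ∣m-n∣≤o (2 * k) (toℕ u) (2 * k + 1) (≤-trans (m≤m+n (2 * k) 1) (m≤n+m _ (toℕ u)))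
                                        (≤-trans (toℕ≤L u) (≤-reflexive L≡2k+[2k+1]))

    middle-last : pathDist middle (fromℕ L) ≡ 2 * k + 1
    middle-last rewrite toℕ-middle | toℕ-fromℕ L | L≡2k+[2k+1] = ∣m-m+n∣≡n (2 * k) (2 * k + 1)

    ecc≥ : ∀ v {e} → (∀ u → pathDist v u ≤ e) → 2 * k + 1 ≤ e
    ecc≥ v v-ecc with toℕ v ≤? 2 * k
    ... | yes v≤2k = ≤-trans (o≤∣m-n∣ (toℕ v) (toℕ (fromℕ L)) _ (inj₂ 2k+1+v≤L)) (v-ecc (fromℕ L))
      where
        2k+1+v≤L : 2 * k + 1 + toℕ v ≤ toℕ (fromℕ L)
        2k+1+v≤L = ≤-trans (+-monoʳ-≤ (2 * k + 1) v≤2k)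
                     (≤-reflexive (trans (+-comm (2 * k + 1) (2 * k)) (trans (sym L≡2k+[2k+1]) (sym (toℕ-fromℕ L)))))
    ... | no v≰2k = ≤-trans (o≤∣m-n∣ (toℕ v) 0 _ (inj₁ (≤-trans (≤-reflexive (+-identityʳ _)) (≤-trans (≤-reflexive (+-comm (2 * k) 1)) (≰⇒> v≰2k)))))
                          (v-ecc zero)

  radius : IsRadius graph (2 * k + 1)
  radius = (middle , f-isEcc (fromℕ L) middle-last middle-ecc) , λ v e v-ecc → ecc≥ v (isEcc⇒f≤ v-ecc)

  private
    k≤L : k ≤ L
    k≤L = ≤-trans (m≤n+m k (3 * k + 1)) (≤-reflexive (sym L≡[3k+1]+k))

    3k+1≤L : 3 * k + 1 ≤ L
    3k+1≤L = ≤-trans (m≤m+n (3 * k + 1) k) (≤-reflexive (sym L≡[3k+1]+k))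

    abstract
      a b : Fin (suc L)
      a = node k k≤L
      b = node (3 * k + 1) 3k+1≤L

      toℕ-a : toℕ a ≡ k
      toℕ-a = toℕ-node k k≤L

      toℕ-b : toℕ b ≡ 3 * k + 1
      toℕ-b = toℕ-node (3 * k + 1) 3k+1≤L

    landmarks : Subset (suc L)
    landmarks = ⁅ a ⁆ ∪ ⁅ b ⁆

    a∈ : a ∈ landmarks
    a∈ = x∈p∪q⁺ (inj₁ (x∈⁅x⁆ a))

    b∈ : b ∈ landmarks
    b∈ = x∈p∪q⁺ (inj₂ (x∈⁅x⁆ b))

    k<3k+1 : k < 3 * k + 1
    k<3k+1 = ≤-trans (≤-reflexive (+-comm 1 k)) (+-monoˡ-≤ 1 (m≤n*m k 3))

    a≢b : a ≢ b
    a≢b a≡b = <⇒≢ k<3k+1 (trans (sym toℕ-a) (trans (cong toℕ a≡b) toℕ-b))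

    ∣landmarks∣ : ∣ landmarks ∣ ≡ 2
    ∣landmarks∣ = trans (∣p∪⁅x⁆∣≡1+∣p∣ ⁅ a ⁆ b (λ b∈⁅a⁆ → a≢b (sym (x∈⁅y⁆⇒x≡y a b∈⁅a⁆)))) (cong suc (∣⁅x⁆∣≡1 a))

    dominating : IsDistKDominating graph k landmarks
    dominating v _ with toℕ v ≤? 2 * k
    ... | yes v≤2k = a , a∈ , _ , f-Dist v a ,
          ∣m-n∣≤o (toℕ v) (toℕ a) k (≤-trans v≤2k (≤-reflexive (trans (regroup k) (cong (_+ k) (sym toℕ-a)))))
                                   (≤-trans (≤-reflexive toℕ-a) (m≤n+m k (toℕ v)))
      where regroup : ∀ k → 2 * k ≡ k + k
            regroup = solve-∀
    ... | no v≰2k = b , b∈ , _ , f-Dist v b ,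
          ∣m-n∣≤o (toℕ v) (toℕ b) k (≤-trans (toℕ≤L v) (≤-reflexive (trans L≡[3k+1]+k (cong (_+ k) (sym toℕ-b)))))
                                   (≤-trans (≤-reflexive toℕ-b) (≤-trans (≤-reflexive (regroup k)) (+-monoˡ-≤ k (≰⇒> v≰2k))))
      where regroup : ∀ k → 3 * k + 1 ≡ suc (2 * k) + k
            regroup = solve-∀

    -- equal distances to both landmarks would force x + y = 2k = 2(3k + 1)
    equidistant⇒≡ : ∀ x y → ∣ x - k ∣ ≡ ∣ y - k ∣ → ∣ x - (3 * k + 1) ∣ ≡ ∣ y - (3 * k + 1) ∣ → x ≡ y
    equidistant⇒≡ x y ≡k ≡3k+1 with ∣m-o∣≡∣n-o∣⇒m≡n⊎m+n≡o+o x y k ≡k | ∣m-o∣≡∣n-o∣⇒m≡n⊎m+n≡o+o x y (3 * k + 1) ≡3k+1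
    ... | inj₁ x≡y | _ = x≡y
    ... | _ | inj₁ x≡y = x≡y
    ... | inj₂ ≡2k | inj₂ ≡2[3k+1] = contradiction (m+m≡n+n⇒m≡n (trans (sym ≡2k) ≡2[3k+1])) (<⇒≢ k<3k+1)

    resolving : IsResolving graph landmarks
    resolving u v u≢v _ _ = separate (pathDist u a ≟ pathDist v a) (pathDist u b ≟ pathDist v b)
      where
        separate : Dec (pathDist u a ≡ pathDist v a) → Dec (pathDist u b ≡ pathDist v b) →
                   Σ (Fin (suc L)) λ w → w ∈ landmarks × (Σ ℕ λ m → Σ ℕ λ m′ → Dist graph u w m × Dist graph v w m′ × m ≢ m′)
        separate (no ≢a) _ = a , a∈ , _ , _ , f-Dist u a , f-Dist v a , ≢a
        separate (yes _) (no ≢b) = b , b∈ , _ , _ , f-Dist u b , f-Dist v b , ≢b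
        separate (yes ≡a) (yes ≡b) = contradiction (toℕ-injective (equidistant⇒≡ (toℕ u) (toℕ v)
          (subst (λ z → ∣ toℕ u - z ∣ ≡ ∣ toℕ v - z ∣) toℕ-a ≡a) (subst (λ z → ∣ toℕ u - z ∣ ≡ ∣ toℕ v - z ∣) toℕ-b ≡b))) u≢v

  γ≡2 : IsGammaRK graph k 2
  γ≡2 = isGammaRK-from-bound 1 landmarks (resolving , dominating) ∣landmarks∣ M<L+1
          λ D′ D′-dom → DominationBounds.diameter-bound graph connected k D′ D′-dom zero diameter
    where
      M<L+1 : (2 * k + 1) * 1 < L + 1
      M<L+1 = ≤-trans (m≤m+n _ (2 * k)) (≤-reflexive (regroup k))
        where regroup : ∀ k → suc ((2 * k + 1) * 1) + 2 * k ≡ 4 * k + 1 + 1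
              regroup = solve-∀

1+m∸n≤1+[m∸n] : ∀ m n → suc m ∸ n ≤ suc (m ∸ n)
1+m∸n≤1+[m∸n] m zero = ≤-refl
1+m∸n≤1+[m∸n] zero (suc n) = ≤-trans (≤-reflexive (0∸n≡0 n)) z≤n
1+m∸n≤1+[m∸n] (suc m) (suc n) = 1+m∸n≤1+[m∸n] m n

module CycleArithmetic (L : ℕ) where

  N : ℕ
  N = suc L

  cycDist : ℕ → ℕ → ℕ
  cycDist a c = ∣ a - c ∣ ⊓ (N ∸ ∣ a - c ∣)

  cycDist-step : ∀ a a′ c → ∣ a - a′ ∣ ≡ 1 → cycDist a c ≤ suc (cycDist a′ c)
  cycDist-step a a′ c ∣a-a′∣≡1 = ⊓-mono-≤ direct around
    where
      direct : ∣ a - c ∣ ≤ suc ∣ a′ - c ∣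
      direct = ≤-trans (∣-∣-triangle a a′ c) (≤-reflexive (cong (_+ ∣ a′ - c ∣) ∣a-a′∣≡1))
      around : N ∸ ∣ a - c ∣ ≤ suc (N ∸ ∣ a′ - c ∣)
      around = ≤-trans (∸-monoʳ-≤ (suc N) a′c≤1+ac) (1+m∸n≤1+[m∸n] N ∣ a′ - c ∣)
        where a′c≤1+ac : ∣ a′ - c ∣ ≤ suc ∣ a - c ∣
              a′c≤1+ac = ≤-trans (∣-∣-triangle a′ a c) (≤-reflexive (cong (_+ ∣ a - c ∣) (trans (∣-∣-comm a′ a) ∣a-a′∣≡1)))

  private
    cycDist-0 : ∀ c → c ≤ L → cycDist 0 c ≡ c ⊓ suc (L ∸ c)
    cycDist-0 c c≤L = cong (c ⊓_) (+-∸-assoc 1 c≤L)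

    cycDist-L : ∀ c → c ≤ L → cycDist L c ≡ (L ∸ c) ⊓ suc c
    cycDist-L c c≤L = trans (cong (λ z → z ⊓ (N ∸ z)) (m≤n⇒∣n-m∣≡n∸m c≤L))
                            (cong ((L ∸ c) ⊓_) (trans (+-∸-assoc 1 (m∸n≤m L c)) (cong suc (m∸[m∸n]≡n c≤L))))

  cycDist-wrap₀ : ∀ c → c ≤ L → cycDist 0 c ≤ suc (cycDist L c)
  cycDist-wrap₀ c c≤L = subst₂ _≤_ (sym (cycDist-0 c c≤L)) (cong suc (sym (cycDist-L c c≤L)))
    (⊓-glb (m⊓n≤n c _) (≤-trans (m⊓n≤m c _) (≤-trans (n≤1+n c) (n≤1+n (suc c)))))

  cycDist-wrapL : ∀ c → c ≤ L → cycDist L c ≤ suc (cycDist 0 c)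
  cycDist-wrapL c c≤L = subst₂ _≤_ (sym (cycDist-L c c≤L)) (cong suc (sym (cycDist-0 c c≤L)))
    (⊓-glb (m⊓n≤n (L ∸ c) (suc c)) (≤-trans (m⊓n≤m (L ∸ c) _) (≤-trans (n≤1+n (L ∸ c)) (n≤1+n _))))

  private
    ∣m-n∣≤N : ∀ m n → m < N → n < N → ∣ m - n ∣ ≤ N
    ∣m-n∣≤N m n m<N n<N = ≤-trans (∣m-n∣≤m⊔n m n) (⊔-lub (<⇒≤ m<N) (<⇒≤ n<N))

    ∣u-w∣+∣v-w∣≡N⇒ : ∀ u v w → u < N → v < N → ∣ u - w ∣ + ∣ v - w ∣ ≡ N → u + v ≡ w + w + N ⊎ u + v + N ≡ w + w
    ∣u-w∣+∣v-w∣≡N⇒ u v w u<N v<N sum≡N with ∣-∣-split u w | ∣-∣-split v w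
    ... | inj₁ (_ , u≡) | inj₁ (_ , v≡) =
          inj₁ (trans (cong₂ _+_ (sym u≡) (sym v≡)) (trans (regroup ∣ u - w ∣ ∣ v - w ∣ w) (cong (w + w +_) sum≡N)))
      where regroup : ∀ a b w → a + w + (b + w) ≡ w + w + (a + b)
            regroup = solve-∀
    ... | inj₂ (_ , w≡) | inj₂ (_ , w≡′) =
          inj₂ (trans (cong (u + v +_) (sym sum≡N)) (trans (regroup u v ∣ u - w ∣ ∣ v - w ∣) (cong₂ _+_ w≡ w≡′)))
      where regroup : ∀ u v a b → u + v + (a + b) ≡ a + u + (b + v)
            regroup = solve-∀
    ... | inj₁ (_ , u≡) | inj₂ (_ , w≡) = contradiction u<N (≤⇒≯ N≤u)
      where N≤u : N ≤ u
            N≤u = ≤-trans (≤-reflexive (sym sum≡N))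
                    (≤-trans (m≤m+n _ v) (≤-reflexive (trans (+-assoc ∣ u - w ∣ ∣ v - w ∣ v) (trans (cong (∣ u - w ∣ +_) w≡) u≡))))
    ... | inj₂ (_ , w≡) | inj₁ (_ , v≡) = contradiction v<N (≤⇒≯ N≤v)
      where N≤v : N ≤ v
            N≤v = ≤-trans (≤-reflexive (sym sum≡N))
                    (≤-trans (m≤m+n _ u) (≤-reflexive (trans (regroup ∣ u - w ∣ ∣ v - w ∣ u) (trans (cong (∣ v - w ∣ +_) w≡) v≡))))
              where regroup : ∀ a b u → a + b + u ≡ b + (a + u)
                    regroup = solve-∀

  cycDist-≡⇒ : ∀ u v w → u < N → v < N → w < N → cycDist u w ≡ cycDist v w →
               u ≡ v ⊎ u + v ≡ w + w ⊎ u + v ≡ w + w + N ⊎ u + v + N ≡ w + w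
  cycDist-≡⇒ u v w u<N v<N w<N eq with ⊓-sel ∣ u - w ∣ (N ∸ ∣ u - w ∣) | ⊓-sel ∣ v - w ∣ (N ∸ ∣ v - w ∣)
  ... | inj₁ e | inj₁ e′ = reflected (∣m-o∣≡∣n-o∣⇒m≡n⊎m+n≡o+o u v w (trans (sym e) (trans eq e′)))
    where reflected : u ≡ v ⊎ u + v ≡ w + w → _
          reflected = map₂ inj₁
  ... | inj₂ e | inj₂ e′ = reflected (∣m-o∣≡∣n-o∣⇒m≡n⊎m+n≡o+o u v w
                             (∸-cancelˡ-≡ (∣m-n∣≤N u w u<N w<N) (∣m-n∣≤N v w v<N w<N) (trans (sym e) (trans eq e′))))
    where reflected : u ≡ v ⊎ u + v ≡ w + w → _
          reflected = map₂ inj₁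
  ... | inj₁ e | inj₂ e′ = inj₂ (inj₂ (∣u-w∣+∣v-w∣≡N⇒ u v w u<N v<N
                             (trans (cong (_+ ∣ v - w ∣) (trans (sym e) (trans eq e′))) (m∸n+n≡m (∣m-n∣≤N v w v<N w<N)))))
  ... | inj₂ e | inj₁ e′ = inj₂ (inj₂ (∣u-w∣+∣v-w∣≡N⇒ u v w u<N v<N
                             (trans (cong (∣ u - w ∣ +_) (trans (sym e′) (trans (sym eq) e))) (m+[n∸m]≡n (∣m-n∣≤N u w u<N w<N)))))

  CyclicAdjacent : ℕ → ℕ → Set
  CyclicAdjacent a c = suc a ≡ c ⊎ suc c ≡ a ⊎ (a ≡ 0 × c ≡ L) ⊎ (c ≡ 0 × a ≡ L)

  -- Cutting the cycle open just after t, a sits at position p of the resulting path.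
  Offset : ℕ → ℕ → ℕ → Set
  Offset t a p = (t < a × p + suc t ≡ a) ⊎ (a < t × p + suc t ≡ a + N)

  offset : ℕ → ℕ → ℕ
  offset t a with t <? a
  ... | yes _ = a ∸ suc t
  ... | no _ = a + N ∸ suc t

  offset-spec : ∀ t a → a ≢ t → t < N → Offset t a (offset t a)
  offset-spec t a a≢t t<N with t <? a
  ... | yes t<a = inj₁ (t<a , m∸n+n≡m t<a)
  ... | no t≮a = inj₂ (≤∧≢⇒< (≮⇒≥ t≮a) a≢t , m∸n+n≡m (≤-trans t<N (m≤n+m N a)))

  offset-injective : ∀ {t a a′ p} → Offset t a p → Offset t a′ p → a < N → a′ < N → a ≡ a′
  offset-injective (inj₁ (_ , a≡)) (inj₁ (_ , a′≡)) _ _ = trans (sym a≡) a′≡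
  offset-injective (inj₂ (_ , a≡)) (inj₂ (_ , a′≡)) _ _ = +-cancelʳ-≡ N _ _ (trans (sym a≡) a′≡)
  offset-injective {a′ = a′} (inj₁ (_ , a≡)) (inj₂ (_ , a′≡)) a<N _ =
    contradiction a<N (≤⇒≯ (≤-trans (m≤n+m N a′) (≤-reflexive (trans (sym a′≡) a≡))))
  offset-injective {a = a} (inj₂ (_ , a≡)) (inj₁ (_ , a′≡)) _ a′<N =
    contradiction a′<N (≤⇒≯ (≤-trans (m≤n+m N a) (≤-reflexive (trans (sym a≡) a′≡))))

  private
    offset-suc : ∀ {t a c p p′} → Offset t a p → Offset t c p′ → suc a ≡ c → p′ ≡ suc p
    offset-suc (inj₁ (_ , a≡)) (inj₁ (_ , c≡)) refl = +-cancelʳ-≡ _ _ _ (trans c≡ (cong suc (sym a≡)))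
    offset-suc (inj₂ (_ , a≡)) (inj₂ (_ , c≡)) refl = +-cancelʳ-≡ _ _ _ (trans c≡ (cong suc (sym a≡)))
    offset-suc {a = a} (inj₁ (t<a , _)) (inj₂ (1+a<t , _)) refl = contradiction t<a (<-asym (≤-trans (n≤1+n _) 1+a<t))
    offset-suc (inj₂ (a<t , _)) (inj₁ (t<1+a , _)) refl = contradiction (≤-trans a<t (≤-pred t<1+a)) (<-irrefl refl)

    offset-wrap : ∀ {t a c p p′} → t < N → Offset t a p → Offset t c p′ → a ≡ 0 → c ≡ L → p ≡ suc p′
    offset-wrap t<N (inj₁ (() , _)) _ refl _
    offset-wrap t<N _ (inj₂ (L<t , _)) _ refl = contradiction (≤-pred t<N) (<⇒≱ L<t)
    offset-wrap t<N (inj₂ (_ , a≡)) (inj₁ (_ , c≡)) refl refl = +-cancelʳ-≡ _ _ _ (trans a≡ (cong suc (sym c≡)))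

  offset-adjacent : ∀ {t a c p p′} → t < N → Offset t a p → Offset t c p′ → CyclicAdjacent a c → p′ ≡ suc p ⊎ p ≡ suc p′
  offset-adjacent t<N a-off c-off (inj₁ 1+a≡c) = inj₁ (offset-suc a-off c-off 1+a≡c)
  offset-adjacent t<N a-off c-off (inj₂ (inj₁ 1+c≡a)) = inj₂ (offset-suc c-off a-off 1+c≡a)
  offset-adjacent t<N a-off c-off (inj₂ (inj₂ (inj₁ (a≡0 , c≡L)))) = inj₂ (offset-wrap t<N a-off c-off a≡0 c≡L)
  offset-adjacent t<N a-off c-off (inj₂ (inj₂ (inj₂ (c≡0 , a≡L)))) = inj₁ (offset-wrap t<N c-off a-off c≡0 a≡L)

a+[1+L∸c]≡1+L∸[c∸a] : ∀ L a c → a ≤ c → c ≤ L → a + suc (L ∸ c) ≡ suc L ∸ (c ∸ a)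
a+[1+L∸c]≡1+L∸[c∸a] L a c a≤c c≤L = begin
    a + suc (L ∸ c)        ≡⟨ +-suc a (L ∸ c) ⟩
    suc (a + (L ∸ c))      ≡⟨ cong suc (sym (m+n∸n≡m (a + (L ∸ c)) (c ∸ a))) ⟩
    suc (a + (L ∸ c) + (c ∸ a) ∸ (c ∸ a)) ≡⟨ cong (λ z → suc (z ∸ (c ∸ a))) L≡ ⟩
    suc (L ∸ (c ∸ a))      ≡⟨ sym (+-∸-assoc 1 (≤-trans (m∸n≤m c a) c≤L)) ⟩
    suc L ∸ (c ∸ a)        ∎
  where
    open ≡-Reasoning
    L≡ : a + (L ∸ c) + (c ∸ a) ≡ L
    L≡ = trans (regroup a (L ∸ c) (c ∸ a)) (trans (cong (_+ (L ∸ c)) (m+[n∸m]≡n a≤c)) (m+[n∸m]≡n c≤L))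
      where regroup : ∀ a r s → a + r + s ≡ a + s + r
            regroup = solve-∀

module CycleGraph (L : ℕ) (2≤L : 2 ≤ L) where
  open CycleArithmetic L public

  private
    adjacent? : ∀ a c → Dec (CyclicAdjacent a c)
    adjacent? a c = (suc a ≟ c) ⊎-dec (suc c ≟ a) ⊎-dec ((a ≟ 0) ×-dec (c ≟ L)) ⊎-dec ((c ≟ 0) ×-dec (a ≟ L))

    adjacent-sym : ∀ {a c} → CyclicAdjacent a c → CyclicAdjacent c a
    adjacent-sym (inj₁ e) = inj₂ (inj₁ e)
    adjacent-sym (inj₂ (inj₁ e)) = inj₁ e
    adjacent-sym (inj₂ (inj₂ (inj₁ e))) = inj₂ (inj₂ (inj₂ e))
    adjacent-sym (inj₂ (inj₂ (inj₂ e))) = inj₂ (inj₂ (inj₁ e))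

    adjacent-irrefl : ∀ {a} → ¬ CyclicAdjacent a a
    adjacent-irrefl (inj₁ e) = <-irrefl (sym e) (n<1+n _)
    adjacent-irrefl (inj₂ (inj₁ e)) = <-irrefl (sym e) (n<1+n _)
    adjacent-irrefl (inj₂ (inj₂ (inj₁ (a≡0 , a≡L)))) = <-irrefl (trans (sym a≡0) a≡L) (≤-trans (s≤s z≤n) 2≤L)
    adjacent-irrefl (inj₂ (inj₂ (inj₂ (a≡0 , a≡L)))) = <-irrefl (trans (sym a≡0) a≡L) (≤-trans (s≤s z≤n) 2≤L)

  open RelationGraph {N} (λ i j → CyclicAdjacent (toℕ i) (toℕ j)) (λ i j → adjacent? (toℕ i) (toℕ j))
                     adjacent-sym adjacent-irrefl public
  open Walks graph
  open ConsecutiveWalks graph (λ 1+i≡j → R⇒edge (inj₁ 1+i≡j))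

  private
    toℕ≤L : ∀ (u : Fin N) → toℕ u ≤ L
    toℕ≤L u = ≤-pred (toℕ<n u)

    wrap-walk : ∀ i j → toℕ i ≤ toℕ j → Walk′ i j (toℕ i + suc (L ∸ toℕ j))
    wrap-walk i j i≤j = reverse (forward-walk zero i z≤n) ++ move _ 0∼L L⇝j
      where
        0∼L : Edge graph zero (fromℕ L)
        0∼L = R⇒edge (inj₂ (inj₂ (inj₁ (refl , toℕ-fromℕ L))))
        L⇝j : Walk′ (fromℕ L) j (L ∸ toℕ j)
        L⇝j = cast (cong (_∸ toℕ j) (toℕ-fromℕ L))
                   (reverse (forward-walk j (fromℕ L) (subst (toℕ j ≤_) (sym (toℕ-fromℕ L)) (toℕ≤L j))))

    cycDist-walk : ∀ i j → Walk′ i j (cycDist (toℕ i) (toℕ j))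
    cycDist-walk i j with ⊓-sel ∣ toℕ i - toℕ j ∣ (N ∸ ∣ toℕ i - toℕ j ∣)
    ... | inj₁ e = cast (sym e) (∣-∣-walk i j)
    ... | inj₂ e with ≤-total (toℕ i) (toℕ j)
    ...   | inj₁ i≤j = cast (trans (a+[1+L∸c]≡1+L∸[c∸a] L _ _ i≤j (toℕ≤L j)) (trans (cong (N ∸_) (sym (m≤n⇒∣m-n∣≡n∸m i≤j))) (sym e)))
                            (wrap-walk i j i≤j)
    ...   | inj₂ j≤i = cast (trans (a+[1+L∸c]≡1+L∸[c∸a] L _ _ j≤i (toℕ≤L i)) (trans (cong (N ∸_) (sym (m≤n⇒∣n-m∣≡n∸m j≤i))) (sym e)))
                            (reverse (wrap-walk j i j≤i))

    cycDist-edge : ∀ {i i′} j → Edge graph i i′ → cycDist (toℕ i) (toℕ j) ≤ suc (cycDist (toℕ i′) (toℕ j))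
    cycDist-edge {i} {i′} j e with edge⇒R e
    ... | inj₁ s = cycDist-step (toℕ i) (toℕ i′) (toℕ j) (∣m-n∣≡1 (inj₁ s))
    ... | inj₂ (inj₁ s) = cycDist-step (toℕ i) (toℕ i′) (toℕ j) (∣m-n∣≡1 (inj₂ s))
    ... | inj₂ (inj₂ (inj₁ (i≡0 , i′≡L))) = subst₂ (λ a a′ → cycDist a (toℕ j) ≤ suc (cycDist a′ (toℕ j)))
                                                    (sym i≡0) (sym i′≡L) (cycDist-wrap₀ (toℕ j) (toℕ≤L j))
    ... | inj₂ (inj₂ (inj₂ (i′≡0 , i≡L))) = subst₂ (λ a a′ → cycDist a (toℕ j) ≤ suc (cycDist a′ (toℕ j)))
                                                    (sym i≡L) (sym i′≡0) (cycDist-wrapL (toℕ j) (toℕ≤L j))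

    cycDist-self : ∀ (j : Fin N) → cycDist (toℕ j) (toℕ j) ≡ 0
    cycDist-self j = cong (λ z → z ⊓ (N ∸ z)) (∣n-n∣≡0 (toℕ j))

  open ExactDistance {N} graph (λ i j → cycDist (toℕ i) (toℕ j)) cycDist-walk cycDist-self cycDist-edge public

  hamiltonian : HasCycleOfLength graph N
  hamiltonian = L , refl , s≤s 2≤L , record
    { vs = λ i → i
    ; inj = λ eq → eq
    ; step = λ i → R⇒edge (inj₁ (cong suc (toℕ-inject₁ i)))
    ; close = R⇒edge (inj₂ (inj₂ (inj₂ (refl , toℕ-fromℕ L)))) }

  private
    missed : ∀ {m} (f : Fin (suc m) → Fin N) → suc m < N → Σ (Fin N) λ z → ∀ i → f i ≢ z
    missed f m<N with ¬∀⟶∃¬ N (λ z → ∃ λ i → f i ≡ z) (λ z → any? (λ i → f i Finₚ.≟ z)) surjective⇒⊥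
      where
        surjective⇒⊥ : ¬ (∀ z → ∃ λ i → f i ≡ z)
        surjective⇒⊥ onto with pigeonhole m<N (λ z → proj₁ (onto z))
        ... | z , z′ , z<z′ , same = <-irrefl (cong toℕ (trans (sym (proj₂ (onto z))) (trans (cong f same) (proj₂ (onto z′))))) z<z′
    ... | z , not-hit = z , λ i fi≡z → not-hit (i , fi≡z)

  -- A shorter cycle misses some vertex z; along the path obtained by cutting the cycle at z,
  -- both cycle-neighbours of the vertex of largest offset would sit one step before it.
  no-shorter-cycle : ∀ {m} → Cycle graph (suc (suc m)) → N ≤ suc (suc (suc m))
  no-shorter-cycle {m} C with N ≤? suc (suc (suc m))
  ... | yes N≤ = N≤
  ... | no N≰ with missed vs (≰⇒> N≰)
    where open Cycle C
  ...   | z , z∉C with argmax zero (λ j → offset (toℕ z) (toℕ (Cycle.vs C j)))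
  ...     | i , i-max = contradiction (inj (toℕ-injective prev≡next)) (prev≢next (s≤s (s≤s z≤n)) i)
    where
      open Cycle C
      open CycleNeighbours C
      t : ℕ
      t = toℕ z
      off : ∀ j → Offset t (toℕ (vs j)) (offset t (toℕ (vs j)))
      off j = offset-spec t (toℕ (vs j)) (λ e → z∉C j (toℕ-injective e)) (toℕ<n z)
      next-below : offset t (toℕ (vs i)) ≡ suc (offset t (toℕ (vs (next i))))
      next-below with offset-adjacent (toℕ<n z) (off i) (off (next i)) (edge⇒R (next-∼ i))
      ... | inj₁ above = contradiction (i-max (next i)) (<⇒≱ (≤-reflexive (sym above)))
      ... | inj₂ below = below
      prev-below : offset t (toℕ (vs i)) ≡ suc (offset t (toℕ (vs (prev i))))
      prev-below with offset-adjacent (toℕ<n z) (off (prev i)) (off i) (edge⇒R (prev-∼ i))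
      ... | inj₁ below = below
      ... | inj₂ above = contradiction (i-max (prev i)) (<⇒≱ (≤-reflexive (sym above)))
      prev≡next : toℕ (vs (prev i)) ≡ toℕ (vs (next i))
      prev≡next = offset-injective (off (prev i))
                    (subst (Offset t (toℕ (vs (next i)))) (suc-injective (trans (sym next-below) prev-below)) (off (next i)))
                    (toℕ<n _) (toℕ<n _)

  girth : IsGirth graph N
  girth = hamiltonian , λ { _ (m , refl , 3≤1+m , C) → no-shorter-cycle′ 3≤1+m C }
    where
      no-shorter-cycle′ : ∀ {m} → 3 ≤ suc m → Cycle graph m → N ≤ suc m
      no-shorter-cycle′ {suc (suc m)} _ C = no-shorter-cycle C
      no-shorter-cycle′ {0} (s≤s ())
      no-shorter-cycle′ {1} (s≤s (s≤s ()))

module CycleSharpness (k : ℕ) where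
  open CycleGraph (6 * k + 2) (m≤n+m 2 (6 * k))

  private
    M : ℕ
    M = 2 * k + 1

    M<N : M < N
    M<N = ≤-trans (s≤s (m≤m+n M (4 * k + 1))) (≤-reflexive (cong suc (regroup k)))
      where regroup : ∀ k → 2 * k + 1 + (4 * k + 1) ≡ 6 * k + 2
            regroup = solve-∀

    2M<N : 2 * M < N
    2M<N = ≤-trans (s≤s (m≤m+n (2 * M) (2 * k))) (≤-reflexive (cong suc (regroup k)))
      where regroup : ∀ k → 2 * (2 * k + 1) + 2 * k ≡ 6 * k + 2
            regroup = solve-∀

    a : Fin N
    a = zero

    abstract
      b c : Fin N
      b = fromℕ< M<N
      c = fromℕ< 2M<N

      toℕ-b : toℕ b ≡ M
      toℕ-b = toℕ-fromℕ< M<N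

      toℕ-c : toℕ c ≡ 2 * M
      toℕ-c = toℕ-fromℕ< 2M<N

    N≡3M : N ≡ M + M + M
    N≡3M = regroup k
      where regroup : ∀ k → suc (6 * k + 2) ≡ 2 * k + 1 + (2 * k + 1) + (2 * k + 1)
            regroup = solve-∀

    0<M : 0 < M
    0<M = m≤n+m 1 (2 * k)

    b≢a : b ≢ a
    b≢a b≡a = <⇒≢ 0<M (sym (trans (sym toℕ-b) (cong toℕ b≡a)))

    c≢a : c ≢ a
    c≢a c≡a = <⇒≢ (≤-trans 0<M (m≤m+n M (M + 0))) (sym (trans (sym toℕ-c) (cong toℕ c≡a)))

    c≢b : c ≢ b
    c≢b c≡b = <⇒≢ (≤-trans (m<m+n M 0<M) (≤-reflexive (cong (M +_) (sym (+-identityʳ M)))))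
                  (trans (sym toℕ-b) (trans (cong toℕ (sym c≡b)) toℕ-c))

    landmarks : Subset N
    landmarks = (⁅ a ⁆ ∪ ⁅ b ⁆) ∪ ⁅ c ⁆

    a∈ : a ∈ landmarks
    a∈ = x∈p∪q⁺ (inj₁ (x∈p∪q⁺ (inj₁ (x∈⁅x⁆ a))))

    b∈ : b ∈ landmarks
    b∈ = x∈p∪q⁺ (inj₁ (x∈p∪q⁺ (inj₂ (x∈⁅x⁆ b))))

    c∈ : c ∈ landmarks
    c∈ = x∈p∪q⁺ (inj₂ (x∈⁅x⁆ c))

    ∣landmarks∣ : ∣ landmarks ∣ ≡ 3
    ∣landmarks∣ = trans (∣p∪⁅x⁆∣≡1+∣p∣ (⁅ a ⁆ ∪ ⁅ b ⁆) c c∉)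
                        (cong suc (trans (∣p∪⁅x⁆∣≡1+∣p∣ ⁅ a ⁆ b (λ b∈ → b≢a (x∈⁅y⁆⇒x≡y a b∈))) (cong suc (∣⁅x⁆∣≡1 a))))
      where
        c∉ : c ∉ ⁅ a ⁆ ∪ ⁅ b ⁆
        c∉ c∈ with x∈p∪q⁻ ⁅ a ⁆ ⁅ b ⁆ c∈
        ... | inj₁ c∈⁅a⁆ = c≢a (x∈⁅y⁆⇒x≡y a c∈⁅a⁆)
        ... | inj₂ c∈⁅b⁆ = c≢b (x∈⁅y⁆⇒x≡y b c∈⁅b⁆)

    dominated-by : ∀ v w → w ∈ landmarks → cycDist (toℕ v) (toℕ w) ≤ k →
                   Σ (Fin N) λ w → w ∈ landmarks × (Σ ℕ λ m → Dist graph v w m × m ≤ k)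
    dominated-by v w w∈ ≤k = w , w∈ , _ , f-Dist v w , ≤k

    dominating : IsDistKDominating graph k landmarks
    dominating v _ with toℕ v ≤? k | toℕ v ≤? 3 * k + 1 | toℕ v ≤? 5 * k + 2
    ... | yes v≤k | _ | _ = dominated-by v a a∈
          (≤-trans (m⊓n≤m _ _) (≤-trans (≤-reflexive (∣-∣-identityʳ (toℕ v))) v≤k))
    ... | no v≰k | yes v≤3k+1 | _ = dominated-by v b b∈ (≤-trans (m⊓n≤m _ _) (subst (λ z → ∣ toℕ v - z ∣ ≤ k) (sym toℕ-b)
          (∣m-n∣≤o (toℕ v) M k (≤-trans v≤3k+1 (≤-reflexive (regroup k))) (≤-trans (≤-reflexive (regroup′ k)) (+-monoˡ-≤ k (≰⇒> v≰k))))))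
      where regroup : ∀ k → 3 * k + 1 ≡ 2 * k + 1 + k
            regroup = solve-∀
            regroup′ : ∀ k → 2 * k + 1 ≡ suc k + k
            regroup′ = solve-∀
    ... | no _ | no v≰3k+1 | yes v≤5k+2 = dominated-by v c c∈ (≤-trans (m⊓n≤m _ _) (subst (λ z → ∣ toℕ v - z ∣ ≤ k) (sym toℕ-c)
          (∣m-n∣≤o (toℕ v) (2 * M) k (≤-trans v≤5k+2 (≤-reflexive (regroup k))) (≤-trans (≤-reflexive (regroup′ k)) (+-monoˡ-≤ k (≰⇒> v≰3k+1))))))
      where regroup : ∀ k → 5 * k + 2 ≡ 2 * (2 * k + 1) + k
            regroup = solve-∀
            regroup′ : ∀ k → 2 * (2 * k + 1) ≡ suc (3 * k + 1) + k
            regroup′ = solve-∀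
    ... | no _ | no _ | no v≰5k+2 = dominated-by v a a∈ (≤-trans (m⊓n≤n _ _) (subst (λ z → N ∸ z ≤ k) (sym (∣-∣-identityʳ (toℕ v)))
          (+-cancelʳ-≤ (toℕ v) _ _ (≤-trans (≤-reflexive (m∸n+n≡m (<⇒≤ (toℕ<n v))))
                                           (≤-trans (≤-reflexive (regroup k)) (+-monoʳ-≤ k (≰⇒> v≰5k+2)))))))
      where regroup : ∀ k → suc (6 * k + 2) ≡ k + suc (5 * k + 2)
            regroup = solve-∀

    -- equal distances to 0 and M force x + y = N and x + y ≡ 2M (mod N), while N = 3M
    equidistant⇒≡ : ∀ x y → x < N → y < N → cycDist x 0 ≡ cycDist y 0 → cycDist x M ≡ cycDist y M → x ≡ y
    equidistant⇒≡ x y x<N y<N ≡0 ≡M with cycDist-≡⇒ x y 0 x<N y<N (s≤s z≤n) ≡0 | cycDist-≡⇒ x y M x<N y<N M<N ≡M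
    ... | inj₁ x≡y | _ = x≡y
    ... | _ | inj₁ x≡y = x≡y
    ... | inj₂ (inj₁ x+y≡0) | _ = trans (m+n≡0⇒m≡0 x x+y≡0) (sym (m+n≡0⇒n≡0 x x+y≡0))
    ... | inj₂ (inj₂ (inj₂ x+y+N≡0)) | _ = contradiction x+y+N≡0 (m+1+n≢0 (x + y) {6 * k + 2})
    ... | inj₂ (inj₂ (inj₁ x+y≡N)) | inj₂ (inj₁ x+y≡2M) = contradiction (trans (sym x+y≡N) x+y≡2M) (>⇒≢ (subst (M + M <_) (sym N≡3M) (m<m+n (M + M) 0<M)))
    ... | inj₂ (inj₂ (inj₁ x+y≡N)) | inj₂ (inj₂ (inj₁ x+y≡2M+N)) = contradiction (trans (sym x+y≡N) x+y≡2M+N) (<⇒≢ (m<n+m N (≤-trans 0<M (m≤m+n M M))))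
    ... | inj₂ (inj₂ (inj₁ x+y≡N)) | inj₂ (inj₂ (inj₂ x+y+N≡2M)) = contradiction (trans (cong (_+ N) (sym x+y≡N)) x+y+N≡2M) (>⇒≢ (+-mono-< M<N M<N))

    resolving : IsResolving graph landmarks
    resolving u v u≢v _ _ = separate (cycDist (toℕ u) 0 ≟ cycDist (toℕ v) 0) (cycDist (toℕ u) (toℕ b) ≟ cycDist (toℕ v) (toℕ b))
      where
        separate : Dec (cycDist (toℕ u) 0 ≡ cycDist (toℕ v) 0) → Dec (cycDist (toℕ u) (toℕ b) ≡ cycDist (toℕ v) (toℕ b)) →
                   Σ (Fin N) λ w → w ∈ landmarks × (Σ ℕ λ m → Σ ℕ λ m′ → Dist graph u w m × Dist graph v w m′ × m ≢ m′)
        separate (no ≢a) _ = a , a∈ , _ , _ , f-Dist u a , f-Dist v a , ≢a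
        separate (yes _) (no ≢b) = b , b∈ , _ , _ , f-Dist u b , f-Dist v b , ≢b
        separate (yes ≡a) (yes ≡b) = contradiction (toℕ-injective (equidistant⇒≡ (toℕ u) (toℕ v) (toℕ<n u) (toℕ<n v) ≡a
                                       (subst (λ z → cycDist (toℕ u) z ≡ cycDist (toℕ v) z) toℕ-b ≡b))) u≢v

  γ≡3 : IsGammaRK graph k 3
  γ≡3 = isGammaRK-from-bound 2 landmarks (resolving , dominating) ∣landmarks∣ (subst (_< N) (*-comm 2 M) 2M<N)
          λ D′ D′-dom → DominationBounds.girth-bound graph connected k D′ D′-dom zero girth

lower-bounds : ∀ k {n} (G : Graph n) → Connected G → ∀ {d r γ} → IsDiameter G d → IsRadius G r → IsGammaRK G k γ →
               (d + 1 ≤ (2 * k + 1) * γ) × (2 * r ≤ (2 * k + 1) * γ) × ((g : ℕ) → IsGirth G g → g ≤ (2 * k + 1) * γ)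
lower-bounds k G connected d-diam r-rad ((D , (_ , dominating) , refl) , _) =
  diameter-bound d-diam , radius-bound r-rad , λ _ → girth-bound
  where open DominationBounds G connected k D dominating (proj₁ (proj₁ d-diam))

diameter-bound-sharp : ∀ k → Σ ℕ λ n → Σ (Graph n) λ G → Connected G × (Σ ℕ λ d → Σ ℕ λ γ →
                       IsDiameter G d × IsGammaRK G k γ × ((2 * k + 1) * γ ≡ d + 1))
diameter-bound-sharp k = _ , graph , connected , _ , 2 , diameter , γ≡2 , regroup k
  where
    open PathGraph (4 * k + 1)
    open PathSharpness k
    regroup : ∀ k → (2 * k + 1) * 2 ≡ 4 * k + 1 + 1
    regroup = solve-∀

radius-bound-sharp : ∀ k → Σ ℕ λ n → Σ (Graph n) λ G → Connected G × (Σ ℕ λ r → Σ ℕ λ γ →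
                     IsRadius G r × IsGammaRK G k γ × ((2 * k + 1) * γ ≡ 2 * r))
radius-bound-sharp k = _ , graph , connected , _ , 2 , radius , γ≡2 , *-comm (2 * k + 1) 2
  where
    open PathGraph (4 * k + 1)
    open PathSharpness k

girth-bound-sharp : ∀ k → Σ ℕ λ n → Σ (Graph n) λ G → Connected G × (Σ ℕ λ g → Σ ℕ λ γ →
                    IsGirth G g × IsGammaRK G k γ × ((2 * k + 1) * γ ≡ g))
girth-bound-sharp k = _ , graph , connected , _ , 3 , girth , γ≡3 , regroup k
  where
    open CycleGraph (6 * k + 2) (m≤n+m 2 (6 * k))
    open CycleSharpness k
    regroup : ∀ k → (2 * k + 1) * 3 ≡ suc (6 * k + 2)
    regroup = solve-∀

proposition2p7 :
    (k : ℕ) → 1 ≤ k →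
      -- the three lower bounds, multiplied out: (2k+1)·γ ≥ d+1, 2r, g
      ((n : ℕ) (G : Graph n) → Connected G →
        (d r γ : ℕ) → IsDiameter G d → IsRadius G r → IsGammaRK G k γ →
          (d + 1 ≤ (2 * k + 1) * γ)
          × (2 * r ≤ (2 * k + 1) * γ)
          × ((g : ℕ) → IsGirth G g → g ≤ (2 * k + 1) * γ))
      -- sharpness of (1)
      × (Σ ℕ λ n → Σ (Graph n) λ G → Connected G × (Σ ℕ λ d → Σ ℕ λ γ →
          IsDiameter G d × IsGammaRK G k γ × ((2 * k + 1) * γ ≡ d + 1)))
      -- sharpness of (2)
      × (Σ ℕ λ n → Σ (Graph n) λ G → Connected G × (Σ ℕ λ r → Σ ℕ λ γ →
          IsRadius G r × IsGammaRK G k γ × ((2 * k + 1) * γ ≡ 2 * r)))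
      -- sharpness of (3)
      × (Σ ℕ λ n → Σ (Graph n) λ G → Connected G × (Σ ℕ λ g → Σ ℕ λ γ →
          IsGirth G g × IsGammaRK G k γ × ((2 * k + 1) * γ ≡ g)))
proposition2p7 k _ =
  (λ n G connected d r γ → lower-bounds k G connected) ,
  diameter-bound-sharp k , radius-bound-sharp k , girth-bound-sharp k
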